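{- Let $p$ be a prime and let $G_1,G_2$ be finite groups satisfying condition $E(p)$. Assume that $G_i$ admits a rational rigid $k_i$-tuple for $i=1,2$, and let $d_i=d(G_i^{ab})$. Then $G_1\times G_2$ admits a rational rigid $s$-tuple, where $s=d_1+d_2+\max(k_1-d_1,k_2-d_2)$.
   Context: Condition $E(p)$: every nontrivial simple quotient of $G$ has order $p$, and no quotient of $[G,G]$ has order $p$. $G^{ab}=G/[G,G]$; $d(H)$ is the minimal number of generators of $H$. A good generating $k$-tuple $(g_1,\dots,g_k)\in G^k$ generates $G$ and satisfies $g_1\cdots g_k=1$. Two good generating tuples are semi-conjugate if $g_i'=h_i^{ -1}g_ih_i$ for some $h_i\in G$ (depending on $i$), and conjugate if this holds with a single $h$. A tuple is rigid if $G$ has trivial center, it is a good generating tuple, and every good generating tuple semi-conjugate to it is conjugate to it. It is rational rigid if in addition each $g_i$ is rational, i.e. $g_i^n$ is conjugate to $g_i$ for all $n$ coprime to $|G|$. -}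

module Defs where

open import Level using (0ℓ)
open import Data.Nat using (ℕ; zero; suc; _≤_; _*_)
open import Data.Nat.Coprimality using (Coprime)
open import Data.Fin using (Fin)
open import Data.Fin.Properties using (*↔×)
open import Data.Vec using (Vec; lookup; foldr)
open import Data.Bool using (Bool; true)
open import Data.Product using (Σ; ∃; ∃₂; _×_; _,_; proj₁; proj₂)
open import Data.Product.Function.NonDependent.Propositional using (_×-↔_)
open import Data.Sum using (_⊎_)
open import Relation.Nullary using (¬_)
open import Relation.Binary.PropositionalEquality
  using (_≡_; _≢_; refl; cong₂; isEquivalence)
open import Algebra.Core using (Op₁; Op₂)
open import Algebra.Structures using (IsGroup)
open import Function.Bundles using (_↔_)
open import Function.Properties.Inverse using (↔-trans)

record FinGroup : Set₁ where
  infixl 7 _∙_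
  field
    Carrier : Set
    _∙_     : Op₂ Carrier
    ε       : Carrier
    _⁻¹     : Op₁ Carrier
    isGroup : IsGroup _≡_ _∙_ ε _⁻¹
    order   : ℕ
    enum    : Fin order ↔ Carrier

  pow : Carrier → ℕ → Carrier
  pow g zero    = ε
  pow g (suc n) = g ∙ pow g n

  comm : Carrier → Carrier → Carrier
  comm a b = a ⁻¹ ∙ b ⁻¹ ∙ a ∙ b

  data Gen (S : Carrier → Set) : Carrier → Set where
    gen : ∀ {x} → S x → Gen S x
    gε  : Gen S ε
    g∙  : ∀ {x y} → Gen S x → Gen S y → Gen S (x ∙ y)
    g⁻¹ : ∀ {x} → Gen S x → Gen S (x ⁻¹)

  InDerived : Carrier → Set
  InDerived = Gen (λ x → ∃₂ λ a b → x ≡ comm a b)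

  InTuple : ∀ {k} → Vec Carrier k → Carrier → Set
  InTuple {k} v x = Σ (Fin k) λ i → lookup v i ≡ x

  Generates : ∀ {k} → Vec Carrier k → Set
  Generates v = ∀ x → Gen (InTuple v) x

  prod : ∀ {k} → Vec Carrier k → Carrier
  prod = foldr _ _∙_ ε

  GoodGenerating : ∀ {k} → Vec Carrier k → Set
  GoodGenerating v = Generates v × prod v ≡ ε

  conj : Carrier → Carrier → Carrier
  conj g h = h ⁻¹ ∙ g ∙ h

  SemiConjugate : ∀ {k} → Vec Carrier k → Vec Carrier k → Set
  SemiConjugate {k} v w = ∀ (i : Fin k) → ∃ λ h → lookup w i ≡ conj (lookup v i) h

  Conjugate : ∀ {k} → Vec Carrier k → Vec Carrier k → Set
  Conjugate {k} v w = ∃ λ h → ∀ (i : Fin k) → lookup w i ≡ conj (lookup v i) h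

  TrivialCenter : Set
  TrivialCenter = ∀ z → (∀ x → z ∙ x ≡ x ∙ z) → z ≡ ε

  Rigid : ∀ {k} → Vec Carrier k → Set
  Rigid v = TrivialCenter × GoodGenerating v
          × (∀ w → GoodGenerating w → SemiConjugate v w → Conjugate v w)

  Rational : Carrier → Set
  Rational g = ∀ n → Coprime n order → ∃ λ h → conj g h ≡ pow g n

  RationalRigid : ∀ {k} → Vec Carrier k → Set
  RationalRigid {k} v = Rigid v × (∀ (i : Fin k) → Rational (lookup v i))

  AdmitsRationalRigid : ℕ → Set
  AdmitsRationalRigid k = ∃ λ (v : Vec Carrier k) → RationalRigid v

  record NormalSubgroup : Set where
    field
      mem    : Carrier → Bool
      has-ε  : mem ε ≡ true
      has-∙  : ∀ x y → mem x ≡ true → mem y ≡ true → mem (x ∙ y) ≡ true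
      has-⁻¹ : ∀ x → mem x ≡ true → mem (x ⁻¹) ≡ true
      normal : ∀ x h → mem x ≡ true → mem (conj x h) ≡ true

  IsSimple : Set
  IsSimple = (∃ λ x → x ≢ ε)
           × (∀ (N : NormalSubgroup) →
                (∀ x → NormalSubgroup.mem N x ≡ true → x ≡ ε)
              ⊎ (∀ x → NormalSubgroup.mem N x ≡ true))

  MinGenerators : ℕ → Set
  MinGenerators d = (∃ λ (v : Vec Carrier d) → Generates v)
                  × (∀ m (v : Vec Carrier m) → Generates v → d ≤ m)

open FinGroup public using (Carrier)

module _ (G H : FinGroup) where
  private
    module G = FinGroup G
    module H = FinGroup H

  IsHom : (G.Carrier → H.Carrier) → Set
  IsHom f = ∀ x y → f (x G.∙ y) ≡ f x H.∙ f y

  Surj : (G.Carrier → H.Carrier) → Set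
  Surj f = ∀ h → ∃ λ x → f x ≡ h

  IsQuotientMap : (G.Carrier → H.Carrier) → Set
  IsQuotientMap f = IsHom f × Surj f

  -- H is a quotient of the derived subgroup [G,G]: a surjective
  -- homomorphism [G,G] → H, where elements of [G,G] are elements of G
  -- together with a proof of membership (the map must not depend on it).
  QuotientOfDerived : Set
  QuotientOfDerived =
    Σ ((x : G.Carrier) → G.InDerived x → H.Carrier) λ f →
        (∀ x (c c′ : G.InDerived x) → f x c ≡ f x c′)
      × (∀ x y (c : G.InDerived x) (d : G.InDerived y) →
           f (x G.∙ y) (G.g∙ c d) ≡ f x c H.∙ f y d)
      × (∀ h → ∃₂ λ x c → f x c ≡ h)

  IsAbelianization : (G.Carrier → H.Carrier) → Set
  IsAbelianization f = IsQuotientMap f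
    × (∀ x → (f x ≡ H.ε → G.InDerived x) × (G.InDerived x → f x ≡ H.ε))

E : ℕ → FinGroup → Set₁
E p G =
    (∀ (H : FinGroup) (f : Carrier G → Carrier H) →
       IsQuotientMap G H f → FinGroup.IsSimple H → FinGroup.order H ≡ p)
  × (∀ (H : FinGroup) → FinGroup.order H ≡ p → ¬ QuotientOfDerived G H)

_⊗_ : FinGroup → FinGroup → FinGroup
G ⊗ H = record
  { Carrier = G.Carrier × H.Carrier
  ; _∙_     = λ a b → (proj₁ a G.∙ proj₁ b , proj₂ a H.∙ proj₂ b)
  ; ε       = (G.ε , H.ε)
  ; _⁻¹     = λ a → (proj₁ a G.⁻¹ , proj₂ a H.⁻¹)
  ; isGroup = record
    { isMonoid = record
      { isSemigroup = record
        { isMagma = record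
          { isEquivalence = isEquivalence
          ; ∙-cong = λ { refl refl → refl } }
        ; assoc = λ a b c → cong₂ _,_ (G.assoc _ _ _) (H.assoc _ _ _) }
      ; identity = (λ a → cong₂ _,_ (G.identityˡ _) (H.identityˡ _))
                 , (λ a → cong₂ _,_ (G.identityʳ _) (H.identityʳ _)) }
    ; inverse = (λ a → cong₂ _,_ (G.inverseˡ _) (H.inverseˡ _))
              , (λ a → cong₂ _,_ (G.inverseʳ _) (H.inverseʳ _))
    ; ⁻¹-cong = λ { refl → refl } }
  ; order   = G.order * H.order
  ; enum    = ↔-trans *↔× (G.enum ×-↔ H.enum)
  }
  where
    module G where
      open FinGroup G public
      open IsGroup isGroup public using (assoc; identityˡ; identityʳ; inverseˡ; inverseʳ)
    module H where
      open FinGroup H public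
      open IsGroup isGroup public using (assoc; identityˡ; identityʳ; inverseˡ; inverseʳ)

-- A rational element g is conjugate to g^(|G|! - 1), so its image in the abelianization has order at
-- most 2. Hence Gᵢ^ab is an elementary abelian 2-group spanned by the images of the rational rigid tuple
-- xᵢ, and greedily choosing entries of xᵢ yields an independent spanning family of at most dᵢ elements.
-- The new tuple of G₁ × G₂ runs through x₁ and x₂ in order, pairing each chosen entry with 1 and the
-- remaining entries of x₁ with those of x₂ (the shorter list eked out with 1s), and is then padded with
-- (1, 1) to length s. Its projections are x₁ and x₂ with identities inserted, which preserves rigidity,
-- rationality and the product relation, and these properties pass to the direct product.
-- For generation, the g with (g, 1) in the generated subgroup H form a normal subgroup N of G₁ (the
-- projections of H are onto) containing the chosen entries, so N[G₁,G₁] = G₁. Condition E(p) forces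
-- N = G₁: a maximal proper normal subgroup M ⊇ N would give a simple quotient G₁/M, of order p by E(p),
-- which is also a quotient of [G₁,G₁] because N ⊆ M supplements [G₁,G₁].

module Submission where

open import Defs hiding (Carrier)
open import Level using (0ℓ)
open import Data.Nat using (ℕ; zero; suc; _+_; _*_; _∸_; _⊔_; _≤_; _^_; _!; s≤s; z≤n; NonZero; ≢-nonZero⁻¹)
open import Data.Nat.Properties
  using ( +-suc; +-comm; +-assoc; +-identityʳ; ⊔-identityʳ; m+n∸m≡n; +-distribˡ-⊔; ⊔-mono-≤; ⊔-monoˡ-≤; +-mono-≤
        ; ≰⇒>; ^-monoʳ-<; <⇒≱; _≤?_; n<1+n; m∸n≤m; ≤-trans; ≤-pred; m<n⇒0<n∸m; m+[n∸m]≡n; <⇒≤; m∸n+n≡m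
        ; 1≤n!; n≢0⇒n>0; module ≤-Reasoning )
open import Data.Nat.Divisibility
  using (_∣_; divides; m∣m*n; ∣-trans; m≤n⇒m!∣n!; ∣m+n∣m⇒∣n; ∣1⇒≡1; ∣⇒≤; 0∣⇒≡0; ∣m⇒∣m*n; ∣n⇒∣m*n)
open import Data.Nat.Coprimality using (Coprime)
open import Data.Nat.Primality using (Prime)
open import Data.Fin using (Fin; zero; suc; toℕ)
open import Data.Fin.Properties
  using (any?; 2↔Bool; *↔×; injective⇒≤; pigeonhole; toℕ<n; nonZeroIndex)
  renaming (_≟_ to _≟ᶠ_; all? to allᶠ?)
open import Data.Fin.Subset using (Subset; _∈_; _∉_; _⊆_; _⊂_; _⊃_)
open import Data.Fin.Subset.Properties using (_∈?_; _⊆?_; _⊂?_; anySubset?)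
open import Data.Fin.Subset.Induction using (⊃-wellFounded; Acc; acc)
open import Data.Vec using (Vec; []; _∷_; lookup; tabulate; map; replicate; zipWith; tail)
open import Data.Vec.Properties using (lookup∘tabulate; lookup⇒[]=; []=⇒lookup; lookup-map; map-replicate)
open import Data.Vec.Relation.Binary.Pointwise.Inductive as Pointwise using (Pointwise; []; _∷_)
open import Data.Vec.Relation.Binary.Pointwise.Extensional using (ext; extensional⇒inductive)
open import Data.Bool using (Bool; true; false; _xor_; if_then_else_)
import Data.Bool as Bool
open import Data.Maybe using (Maybe; just; nothing; fromMaybe)
import Data.Maybe as Maybe
open import Data.Product using (Σ; ∃; ∃₂; _×_; _,_; proj₁; proj₂)
open import Data.Product.Function.NonDependent.Propositional using (_×-↔_)
open import Data.Sum using (_⊎_; inj₁; inj₂)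
open import Data.Empty using (⊥; ⊥-elim)
open import Relation.Nullary
  using (¬_; Dec; yes; no; does; map′; contradiction; Irrelevant; ¬?; _×-dec_; _⊎-dec_; _→-dec_)
open import Relation.Nullary.Decidable using (dec-true; decidable-stable)
open import Relation.Binary.PropositionalEquality hiding ([_])
open import Function using (id; _∘_; _⇔_; Equivalence)
open import Function.Bundles using (_↔_; mk↔ₛ′; mk⇔; Inverse)
open import Function.Definitions using (Injective)
open import Function.Properties.Inverse using (↔-sym; ↔-trans)
open import Algebra.Bundles using (Group; AbelianGroup)
open import Algebra.Structures using (IsGroup)
open import Axiom.UniquenessOfIdentityProofs using (module Decidable⇒UIP)
import Algebra.Properties.Group as GroupProperties
import Algebra.Properties.CommutativeSemigroup as CommutativeSemigroupProperties

-- Tuples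

InVec : ∀ {A : Set} {n} → Vec A n → A → Set
InVec {n = n} v a = Σ (Fin n) λ i → lookup v i ≡ a

InVec-there : ∀ {A : Set} {n} {v : Vec A n} {a b} → InVec v a → InVec (b ∷ v) a
InVec-there (i , e) = suc i , e

Vec-suc↔× : ∀ {A : Set} {n} → Vec A (suc n) ↔ (A × Vec A n)
Vec-suc↔× = mk↔ₛ′ (λ { (x ∷ xs) → x , xs }) (λ (x , xs) → x ∷ xs) (λ _ → refl) (λ { (x ∷ xs) → refl })

Vec-Bool↔Fin : ∀ m → Vec Bool m ↔ Fin (2 ^ m)
Vec-Bool↔Fin zero    = mk↔ₛ′ (λ _ → zero) (λ _ → []) (λ { zero → refl }) (λ { [] → refl })
Vec-Bool↔Fin (suc m) = ↔-trans Vec-suc↔× (↔-trans (↔-sym 2↔Bool ×-↔ Vec-Bool↔Fin m) (↔-sym *↔×))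

Vec-Bool-injective⇒≤ : ∀ {m n} (f : Vec Bool m → Vec Bool n) → Injective _≡_ _≡_ f → m ≤ n
Vec-Bool-injective⇒≤ {m} {n} f f-injective with m ≤? n
... | yes m≤n = m≤n
... | no  m≰n = contradiction (injective⇒≤ f′-injective) (<⇒≱ (^-monoʳ-< 2 (s≤s (s≤s z≤n)) (≰⇒> m≰n)))
  where
  module Eₘ = Inverse (Vec-Bool↔Fin m)
  module Eₙ = Inverse (Vec-Bool↔Fin n)
  f′-injective : Injective _≡_ _≡_ (Eₙ.to ∘ f ∘ Eₘ.from)
  f′-injective {x} {y} e = begin
    x                   ≡⟨ sym (Eₘ.strictlyInverseˡ x) ⟩
    Eₘ.to (Eₘ.from x)   ≡⟨ cong Eₘ.to (f-injective (to-injective e)) ⟩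
    Eₘ.to (Eₘ.from y)   ≡⟨ Eₘ.strictlyInverseˡ y ⟩
    y                   ∎
    where
    open ≡-Reasoning
    to-injective : ∀ {u v} → Eₙ.to u ≡ Eₙ.to v → u ≡ v
    to-injective {u} {v} e =
      trans (sym (Eₙ.strictlyInverseʳ u)) (trans (cong Eₙ.from e) (Eₙ.strictlyInverseʳ v))

trues : ∀ {k} → Vec Bool k → ℕ
trues []          = 0
trues (true ∷ f)  = suc (trues f)
trues (false ∷ f) = trues f

falses : ∀ {k} → Vec Bool k → ℕ
falses []          = 0
falses (true ∷ f)  = falses f
falses (false ∷ f) = suc (falses f)

trues+falses : ∀ {k} (f : Vec Bool k) → trues f + falses f ≡ k
trues+falses []          = refl
trues+falses (true ∷ f)  = cong suc (trues+falses f)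
trues+falses (false ∷ f) = trans (+-suc (trues f) (falses f)) (cong suc (trues+falses f))

select : ∀ {A : Set} {k} (f : Vec Bool k) → Vec A k → Vec A (trues f)
select []          []       = []
select (true ∷ f)  (x ∷ xs) = x ∷ select f xs
select (false ∷ f) (x ∷ xs) = select f xs

select-map : ∀ {A B : Set} {k} (g : A → B) (f : Vec Bool k) (xs : Vec A k) →
             select f (map g xs) ≡ map g (select f xs)
select-map g []          []       = refl
select-map g (true ∷ f)  (x ∷ xs) = cong (g x ∷_) (select-map g f xs)
select-map g (false ∷ f) (x ∷ xs) = select-map g f xs

-- Pad e u x: u is obtained from x by inserting copies of e.
data Pad {A : Set} (e : A) : ∀ {s k} → Vec A s → Vec A k → Set where
  []   : Pad e [] []
  keep : ∀ {s k} {u : Vec A s} {x : Vec A k} a → Pad e u x → Pad e (a ∷ u) (a ∷ x)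
  skip : ∀ {s k} {u : Vec A s} {x : Vec A k} → Pad e u x → Pad e (e ∷ u) x

module _ {A : Set} {e : A} where

  pad-∈ : ∀ {s k} {u : Vec A s} {x : Vec A k} → Pad e u x → ∀ {a} → InVec x a → InVec u a
  pad-∈ (keep a p) (zero  , refl) = zero , refl
  pad-∈ (keep a p) (suc i , q)    = InVec-there (pad-∈ p (i , q))
  pad-∈ (skip p)   q              = InVec-there (pad-∈ p q)

  pad-∈⁻ : ∀ {s k} {u : Vec A s} {x : Vec A k} → Pad e u x → ∀ {a} → InVec u a → InVec x a ⊎ a ≡ e
  pad-∈⁻ (keep a p) (zero  , refl) = inj₁ (zero , refl)
  pad-∈⁻ (keep a p) (suc i , q) with pad-∈⁻ p (i , q)
  ... | inj₁ r   = inj₁ (InVec-there r)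
  ... | inj₂ a≡e = inj₂ a≡e
  pad-∈⁻ (skip p)   (zero  , refl) = inj₂ refl
  pad-∈⁻ (skip p)   (suc i , q)    = pad-∈⁻ p (i , q)

  pad-lookup : ∀ {P : A → Set} → P e → ∀ {s k} {u : Vec A s} {x : Vec A k} → Pad e u x →
               (∀ i → P (lookup x i)) → ∀ i → P (lookup u i)
  pad-lookup Pe (keep a p) Px zero    = Px zero
  pad-lookup Pe (keep a p) Px (suc i) = pad-lookup Pe p (λ j → Px (suc j)) i
  pad-lookup Pe (skip p)   Px zero    = Pe
  pad-lookup Pe (skip p)   Px (suc i) = pad-lookup Pe p Px i

  -- A relation R that only relates e to e can be moved back and forth along a padding.
  unpad : ∀ {R : A → A → Set} → (∀ {b} → R e b → b ≡ e) →
          ∀ {s k} {u : Vec A s} {x : Vec A k} → Pad e u x → ∀ {w : Vec A s} → Pointwise R u w →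
          ∃ λ (w′ : Vec A k) → Pad e w w′ × Pointwise R x w′ ×
                   (∀ {S : A → A → Set} → S e e → Pointwise S x w′ → Pointwise S u w)
  unpad R-e []         []        = [] , [] , [] , λ _ _ → []
  unpad R-e (keep a p) (r ∷ rs)  with unpad R-e p rs
  ... | w′ , q , rs′ , back = _ , keep _ q , r ∷ rs′ , λ { Se (s ∷ ss) → s ∷ back Se ss }
  unpad R-e (skip p)   (r ∷ rs)  with unpad R-e p rs | R-e r
  ... | w′ , q , rs′ , back | refl = w′ , skip q , rs′ , λ Se ss → Se ∷ back Se ss

  fit : ∀ {L s} → L ≤ s → Vec A L → Vec A s
  fit z≤n       []      = replicate _ e
  fit (s≤s L≤s) (a ∷ u) = a ∷ fit L≤s u

  pad-fit : ∀ {L s k} (L≤s : L ≤ s) {u : Vec A L} {x : Vec A k} → Pad e u x → Pad e (fit L≤s u) x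
  pad-fit z≤n       []         = pad-replicate _
    where
    pad-replicate : ∀ s → Pad e (replicate s e) []
    pad-replicate zero    = []
    pad-replicate (suc s) = skip (pad-replicate s)
  pad-fit (s≤s L≤s) (keep a p) = keep a (pad-fit L≤s p)
  pad-fit (s≤s L≤s) (skip p)   = skip (pad-fit L≤s p)

  fit-∈ : ∀ {L s} (L≤s : L ≤ s) {u : Vec A L} {a} → InVec u a → InVec (fit L≤s u) a
  fit-∈ (s≤s L≤s) {_ ∷ _} (zero  , q) = zero , q
  fit-∈ (s≤s L≤s) {_ ∷ _} (suc i , q) = InVec-there (fit-∈ L≤s (i , q))

map-fit : ∀ {A B : Set} (f : A → B) {e : A} {L s} (L≤s : L ≤ s) (u : Vec A L) →
          map f (fit {e = e} L≤s u) ≡ fit {e = f e} L≤s (map f u)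
map-fit f {e} z≤n       []      = map-replicate f e _
map-fit f     (s≤s L≤s) (a ∷ u) = cong (f a ∷_) (map-fit f L≤s u)

-- Chosen entries of either side are paired with the other side's unit, unchosen ones are paired up.
mergeLength : ∀ {k₁ k₂} → Vec Bool k₁ → Vec Bool k₂ → ℕ
mergeLength []          []          = 0
mergeLength []          (_ ∷ g)     = suc (mergeLength [] g)
mergeLength (true ∷ f)  g           = suc (mergeLength f g)
mergeLength (false ∷ f) []          = suc (mergeLength f [])
mergeLength (false ∷ f) (true ∷ g)  = suc (mergeLength (false ∷ f) g)
mergeLength (false ∷ f) (false ∷ g) = suc (mergeLength f g)

mergeLength≡ : ∀ {k₁ k₂} (f : Vec Bool k₁) (g : Vec Bool k₂) →
               mergeLength f g ≡ trues f + trues g + (falses f ⊔ falses g)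
mergeLength≡ []          []          = refl
mergeLength≡ []          (true ∷ g)  = cong suc (mergeLength≡ [] g)
mergeLength≡ []          (false ∷ g) = trans (cong suc (mergeLength≡ [] g)) (sym (+-suc _ _))
mergeLength≡ (true ∷ f)  g           = cong suc (mergeLength≡ f g)
mergeLength≡ (false ∷ f) []          =
  trans (cong suc (trans (mergeLength≡ f []) (cong (trues f + 0 +_) (⊔-identityʳ (falses f)))))
        (sym (+-suc _ _))
mergeLength≡ (false ∷ f) (true ∷ g)  =
  trans (cong suc (mergeLength≡ (false ∷ f) g)) (cong (_+ (suc (falses f) ⊔ falses g)) (sym (+-suc _ _)))
mergeLength≡ (false ∷ f) (false ∷ g) = trans (cong suc (mergeLength≡ f g)) (sym (+-suc _ _))

m+[n∸m]≡m⊔n : ∀ m n → m + (n ∸ m) ≡ m ⊔ n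
m+[n∸m]≡m⊔n zero    n       = refl
m+[n∸m]≡m⊔n (suc m) zero    = cong suc (+-identityʳ m)
m+[n∸m]≡m⊔n (suc m) (suc n) = cong suc (m+[n∸m]≡m⊔n m n)

mergeLength-bound : ∀ {k₁ k₂ d₁ d₂} (f : Vec Bool k₁) (g : Vec Bool k₂) →
                    trues f ≤ d₁ → trues g ≤ d₂ →
                    mergeLength f g ≤ d₁ + d₂ + ((k₁ ∸ d₁) ⊔ (k₂ ∸ d₂))
mergeLength-bound {k₁} {k₂} {d₁} {d₂} f g t₁≤d₁ t₂≤d₂ = begin
  mergeLength f g                                ≡⟨ mergeLength≡ f g ⟩
  t₁ + t₂ + (falses f ⊔ falses g)                 ≡⟨ cong₂ (λ a b → t₁ + t₂ + (a ⊔ b)) (falses≡ f) (falses≡ g) ⟩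
  t₁ + t₂ + ((k₁ ∸ t₁) ⊔ (k₂ ∸ t₂))               ≡⟨ +-distribˡ-⊔ (t₁ + t₂) _ _ ⟩
  (t₁ + t₂ + (k₁ ∸ t₁)) ⊔ (t₁ + t₂ + (k₂ ∸ t₂))   ≤⟨ ⊔-mono-≤ first second ⟩
  (d₁ + d₂ + (k₁ ∸ d₁)) ⊔ (d₁ + d₂ + (k₂ ∸ d₂))   ≡⟨ +-distribˡ-⊔ (d₁ + d₂) _ _ ⟨
  d₁ + d₂ + ((k₁ ∸ d₁) ⊔ (k₂ ∸ d₂))               ∎
  where
  open ≤-Reasoning
  t₁ = trues f
  t₂ = trues g

  falses≡ : ∀ {k} (h : Vec Bool k) → falses h ≡ k ∸ trues h
  falses≡ h = trans (sym (m+n∸m≡n (trues h) (falses h))) (cong (_∸ trues h) (trues+falses h))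

  +∸-mono : ∀ {m n} k → m ≤ n → m + (k ∸ m) ≤ n + (k ∸ n)
  +∸-mono {m} {n} k m≤n = begin
    m + (k ∸ m) ≡⟨ m+[n∸m]≡m⊔n m k ⟩
    m ⊔ k       ≤⟨ ⊔-monoˡ-≤ k m≤n ⟩
    n ⊔ k       ≡⟨ m+[n∸m]≡m⊔n n k ⟨
    n + (k ∸ n) ∎

  swap : ∀ a b c → a + b + c ≡ b + (a + c)
  swap a b c = trans (cong (_+ c) (+-comm a b)) (+-assoc b a c)

  first : t₁ + t₂ + (k₁ ∸ t₁) ≤ d₁ + d₂ + (k₁ ∸ d₁)
  first = begin
    t₁ + t₂ + (k₁ ∸ t₁)   ≡⟨ swap t₁ t₂ _ ⟩
    t₂ + (t₁ + (k₁ ∸ t₁)) ≤⟨ +-mono-≤ t₂≤d₂ (+∸-mono k₁ t₁≤d₁) ⟩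
    d₂ + (d₁ + (k₁ ∸ d₁)) ≡⟨ swap d₁ d₂ _ ⟨
    d₁ + d₂ + (k₁ ∸ d₁)   ∎

  second : t₁ + t₂ + (k₂ ∸ t₂) ≤ d₁ + d₂ + (k₂ ∸ d₂)
  second = begin
    t₁ + t₂ + (k₂ ∸ t₂)   ≡⟨ +-assoc t₁ t₂ _ ⟩
    t₁ + (t₂ + (k₂ ∸ t₂)) ≤⟨ +-mono-≤ t₁≤d₁ (+∸-mono k₂ t₂≤d₂) ⟩
    d₁ + (d₂ + (k₂ ∸ d₂)) ≡⟨ +-assoc d₁ d₂ _ ⟨
    d₁ + d₂ + (k₂ ∸ d₂)   ∎

module Merge {A B : Set} (e₁ : A) (e₂ : B) where

  merge : ∀ {k₁ k₂} → Vec A k₁ → (f : Vec Bool k₁) → Vec B k₂ → (g : Vec Bool k₂) →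
          Vec (A × B) (mergeLength f g)
  merge []      []          []      []          = []
  merge []      []          (b ∷ y) (_ ∷ g)     = (e₁ , b) ∷ merge [] [] y g
  merge (a ∷ x) (true ∷ f)  y       g           = (a , e₂) ∷ merge x f y g
  merge (a ∷ x) (false ∷ f) []      []          = (a , e₂) ∷ merge x f [] []
  merge (a ∷ x) (false ∷ f) (b ∷ y) (true ∷ g)  = (e₁ , b) ∷ merge (a ∷ x) (false ∷ f) y g
  merge (a ∷ x) (false ∷ f) (b ∷ y) (false ∷ g) = (a , b) ∷ merge x f y g

  merge-pad₁ : ∀ {k₁ k₂} (x : Vec A k₁) f (y : Vec B k₂) g → Pad e₁ (map proj₁ (merge x f y g)) x
  merge-pad₁ []      []          []      []          = []
  merge-pad₁ []      []          (b ∷ y) (_ ∷ g)     = skip (merge-pad₁ [] [] y g)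
  merge-pad₁ (a ∷ x) (true ∷ f)  y       g           = keep a (merge-pad₁ x f y g)
  merge-pad₁ (a ∷ x) (false ∷ f) []      []          = keep a (merge-pad₁ x f [] [])
  merge-pad₁ (a ∷ x) (false ∷ f) (b ∷ y) (true ∷ g)  = skip (merge-pad₁ (a ∷ x) (false ∷ f) y g)
  merge-pad₁ (a ∷ x) (false ∷ f) (b ∷ y) (false ∷ g) = keep a (merge-pad₁ x f y g)

  merge-pad₂ : ∀ {k₁ k₂} (x : Vec A k₁) f (y : Vec B k₂) g → Pad e₂ (map proj₂ (merge x f y g)) y
  merge-pad₂ []      []          []      []          = []
  merge-pad₂ []      []          (b ∷ y) (_ ∷ g)     = keep b (merge-pad₂ [] [] y g)
  merge-pad₂ (a ∷ x) (true ∷ f)  y       g           = skip (merge-pad₂ x f y g)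
  merge-pad₂ (a ∷ x) (false ∷ f) []      []          = skip (merge-pad₂ x f [] [])
  merge-pad₂ (a ∷ x) (false ∷ f) (b ∷ y) (true ∷ g)  = keep b (merge-pad₂ (a ∷ x) (false ∷ f) y g)
  merge-pad₂ (a ∷ x) (false ∷ f) (b ∷ y) (false ∷ g) = keep b (merge-pad₂ x f y g)

  merge-chosen₁ : ∀ {k₁ k₂} (x : Vec A k₁) f (y : Vec B k₂) g {a} →
                  InVec (select f x) a → InVec (merge x f y g) (a , e₂)
  merge-chosen₁ (a ∷ x) (true ∷ f)  y       g           (zero  , refl) = zero , refl
  merge-chosen₁ (a ∷ x) (true ∷ f)  y       g           (suc i , q) = InVec-there (merge-chosen₁ x f y g (i , q))
  merge-chosen₁ (a ∷ x) (false ∷ f) []      []          q = InVec-there (merge-chosen₁ x f [] [] q)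
  merge-chosen₁ (a ∷ x) (false ∷ f) (b ∷ y) (true ∷ g)  q = InVec-there (merge-chosen₁ (a ∷ x) (false ∷ f) y g q)
  merge-chosen₁ (a ∷ x) (false ∷ f) (b ∷ y) (false ∷ g) q = InVec-there (merge-chosen₁ x f y g q)

  merge-chosen₂ : ∀ {k₁ k₂} (x : Vec A k₁) f (y : Vec B k₂) g {b} →
                  InVec (select g y) b → InVec (merge x f y g) (e₁ , b)
  merge-chosen₂ []      []          (b ∷ y) (true ∷ g)  (zero  , refl) = zero , refl
  merge-chosen₂ []      []          (b ∷ y) (true ∷ g)  (suc i , q) = InVec-there (merge-chosen₂ [] [] y g (i , q))
  merge-chosen₂ []      []          (b ∷ y) (false ∷ g) q = InVec-there (merge-chosen₂ [] [] y g q)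
  merge-chosen₂ (a ∷ x) (true ∷ f)  y       g           q = InVec-there (merge-chosen₂ x f y g q)
  merge-chosen₂ (a ∷ x) (false ∷ f) (b ∷ y) (true ∷ g)  (zero  , refl) = zero , refl
  merge-chosen₂ (a ∷ x) (false ∷ f) (b ∷ y) (true ∷ g)  (suc i , q) =
    InVec-there (merge-chosen₂ (a ∷ x) (false ∷ f) y g (i , q))
  merge-chosen₂ (a ∷ x) (false ∷ f) (b ∷ y) (false ∷ g) q = InVec-there (merge-chosen₂ x f y g q)

  module Padded {k₁ k₂ s} (x : Vec A k₁) (f : Vec Bool k₁) (y : Vec B k₂) (g : Vec Bool k₂)
                (L≤s : mergeLength f g ≤ s) where

    merged : Vec (A × B) s
    merged = fit {e = e₁ , e₂} L≤s (merge x f y g)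

    merged-pad₁ : Pad e₁ (map proj₁ merged) x
    merged-pad₁ = subst (λ u → Pad e₁ u x) (sym (map-fit proj₁ L≤s _)) (pad-fit L≤s (merge-pad₁ x f y g))

    merged-pad₂ : Pad e₂ (map proj₂ merged) y
    merged-pad₂ = subst (λ u → Pad e₂ u y) (sym (map-fit proj₂ L≤s _)) (pad-fit L≤s (merge-pad₂ x f y g))

    merged-chosen₁ : ∀ {a} → InVec (select f x) a → InVec merged (a , e₂)
    merged-chosen₁ = fit-∈ L≤s ∘ merge-chosen₁ x f y g

    merged-chosen₂ : ∀ {b} → InVec (select g y) b → InVec merged (e₁ , b)
    merged-chosen₂ = fit-∈ L≤s ∘ merge-chosen₂ x f y g

-- Searching finite sets

module _ {n : ℕ} where

  ⊆-¬⊂⇒⊇ : {p q : Subset n} → p ⊆ q → ¬ (p ⊂ q) → q ⊆ p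
  ⊆-¬⊂⇒⊇ {p} p⊆q p⊄q {x} x∈q with x ∈? p
  ... | yes x∈p = x∈p
  ... | no  x∉p = contradiction ((λ {y} → p⊆q {y}) , x , x∈q , x∉p) p⊄q

  module _ (f : Subset n → Subset n) (f-inflationary : ∀ {C} → C ⊆ f C)
           (I : Subset n → Set) (f-preserves : ∀ {C} → I C → I (f C)) where

    fixpoint-above : ∀ {C} → I C → ∃ λ F → I F × C ⊆ F × f F ⊆ F
    fixpoint-above {C} = go C (⊃-wellFounded C)
      where
      go : ∀ C → Acc _⊃_ C → I C → ∃ λ F → I F × C ⊆ F × f F ⊆ F
      go C (acc rec) iC with C ⊂? f C
      ... | no  C⊄fC = C , iC , id , ⊆-¬⊂⇒⊇ f-inflationary C⊄fC
      ... | yes C⊂fC with go (f C) (rec C⊂fC) (f-preserves iC)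
      ...   | F , iF , fC⊆F , fF⊆F = F , iF , (λ x∈C → fC⊆F (f-inflationary x∈C)) , fF⊆F

  module _ (P : Subset n → Set) (P? : ∀ K → Dec (P K)) where

    maximal-above : ∀ {C} → P C → ∃ λ M → P M × C ⊆ M × (∀ {K} → P K → M ⊆ K → K ⊆ M)
    maximal-above {C} = go C (⊃-wellFounded C)
      where
      go : ∀ C → Acc _⊃_ C → P C → ∃ λ M → P M × C ⊆ M × (∀ {K} → P K → M ⊆ K → K ⊆ M)
      go C (acc rec) pC with anySubset? (λ K → P? K ×-dec C ⊂? K)
      ... | no ∄K = C , pC , id , λ {K} pK C⊆K → ⊆-¬⊂⇒⊇ C⊆K (λ C⊂K → ∄K (K , pK , C⊂K))
      ... | yes (K , pK , C⊂K) with go K (rec C⊂K) pK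
      ...   | M , pM , K⊆M , max = M , pM , (λ x∈C → K⊆M (proj₁ C⊂K x∈C)) , max

first : ∀ {m} {P : Fin m → Set} → (∀ i → Dec (P i)) → Maybe (Fin m)
first {zero}  P? = nothing
first {suc m} P? = if does (P? zero) then just zero else Maybe.map suc (first (P? ∘ suc))

first-sound : ∀ {m} {P : Fin m → Set} (P? : ∀ i → Dec (P i)) {i} → first P? ≡ just i → P i
first-sound {suc m} P? e with P? zero
first-sound {suc m} P? refl | yes p = p
first-sound {suc m} P? e    | no _ with first (P? ∘ suc) in eq
first-sound {suc m} P? refl | no _ | just j = first-sound (P? ∘ suc) eq

first-complete : ∀ {m} {P : Fin m → Set} (P? : ∀ i → Dec (P i)) {i} → P i → ∃ λ j → first P? ≡ just j
first-complete {suc m} P? {i} p with P? zero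
... | yes _ = zero , refl
first-complete {suc m} P? {zero}  p | no ¬p = contradiction p ¬p
first-complete {suc m} P? {suc i} p | no _ with first-complete (P? ∘ suc) p
... | j , e rewrite e = suc j , refl

first-cong : ∀ {m} {P Q : Fin m → Set} (P? : ∀ i → Dec (P i)) (Q? : ∀ i → Dec (Q i)) →
             (∀ i → P i ⇔ Q i) → first P? ≡ first Q?
first-cong {zero}  P? Q? P⇔Q = refl
first-cong {suc m} P? Q? P⇔Q with P? zero | Q? zero
... | yes _ | yes _ = refl
... | yes p | no ¬q = contradiction (Equivalence.to (P⇔Q zero) p) ¬q
... | no ¬p | yes q = contradiction (Equivalence.from (P⇔Q zero) q) ¬p
... | no _  | no _  = cong (Maybe.map suc) (first-cong (P? ∘ suc) (Q? ∘ suc) (P⇔Q ∘ suc))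

Σ-Fin↔Fin : ∀ {m} {P : Fin m → Set} → (∀ i → Dec (P i)) → (∀ i → Irrelevant (P i)) →
            Σ ℕ λ r → Fin r ↔ Σ (Fin m) P
Σ-Fin↔Fin {zero} P? P-irr = 0 , mk↔ₛ′ (λ ()) (λ { (() , _) }) (λ { (() , _) }) (λ ())
Σ-Fin↔Fin {suc m} {P} P? P-irr with Σ-Fin↔Fin (P? ∘ suc) (P-irr ∘ suc) | P? zero
... | r , e | yes p₀ = suc r , mk↔ₛ′ to from to-from from-to
  where
  module e = Inverse e
  to : Fin (suc r) → Σ (Fin (suc m)) P
  to zero    = zero , p₀
  to (suc i) = suc (proj₁ (e.to i)) , proj₂ (e.to i)
  from : Σ (Fin (suc m)) P → Fin (suc r)
  from (zero  , _) = zero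
  from (suc i , p) = suc (e.from (i , p))
  to-from : ∀ y → to (from y) ≡ y
  to-from (zero  , p) = cong (zero ,_) (P-irr zero p₀ p)
  to-from (suc i , p) rewrite e.strictlyInverseˡ (i , p) = refl
  from-to : ∀ x → from (to x) ≡ x
  from-to zero    = refl
  from-to (suc i) = cong suc (e.strictlyInverseʳ i)
... | r , e | no ¬p₀ = r , mk↔ₛ′ to from to-from e.strictlyInverseʳ
  where
  module e = Inverse e
  to : Fin r → Σ (Fin (suc m)) P
  to i = suc (proj₁ (e.to i)) , proj₂ (e.to i)
  from : Σ (Fin (suc m)) P → Fin r
  from (zero  , p) = contradiction p ¬p₀
  from (suc i , p) = e.from (i , p)
  to-from : ∀ y → to (from y) ≡ y
  to-from (zero  , p) = contradiction p ¬p₀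
  to-from (suc i , p) rewrite e.strictlyInverseˡ (i , p) = refl

-- Finite groups

module FinGroupProperties (G : FinGroup) where
  open FinGroup G public
  open IsGroup isGroup public using (assoc; identityˡ; identityʳ; inverseˡ; inverseʳ)

  group : Group 0ℓ 0ℓ
  group = record { isGroup = isGroup }

  open GroupProperties group public
    using ( ∙-cancelˡ; inverseʳ-unique; ε⁻¹≈ε; ⁻¹-involutive; ⁻¹-anti-homo-∙
          ; \\-leftDividesˡ; //-rightDividesˡ; //-rightDividesʳ )

  open ≡-Reasoning

  elem : Fin order → Carrier
  elem = Inverse.to enum

  index : Carrier → Fin order
  index = Inverse.from enum

  elem-index : ∀ g → elem (index g) ≡ g
  elem-index = Inverse.strictlyInverseˡ enum

  index-elem : ∀ i → index (elem i) ≡ i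
  index-elem = Inverse.strictlyInverseʳ enum

  infix 4 _≟_
  _≟_ : (g h : Carrier) → Dec (g ≡ h)
  g ≟ h = map′ (λ e → trans (sym (elem-index g)) (trans (cong elem e) (elem-index h)))
               (cong index) (index g ≟ᶠ index h)

  all? : {P : Carrier → Set} → (∀ g → Dec (P g)) → Dec (∀ g → P g)
  all? {P} P? = map′ (λ ∀i g → subst P (elem-index g) (∀i (index g))) (λ ∀g i → ∀g (elem i))
                     (allᶠ? (λ i → P? (elem i)))

  conj-ε : ∀ h → conj ε h ≡ ε
  conj-ε h = trans (cong (_∙ h) (identityʳ (h ⁻¹))) (inverseˡ h)

  ∙-conj : ∀ g h → h ∙ conj g h ≡ g ∙ h
  ∙-conj g h = trans (sym (assoc h _ h)) (cong (_∙ h) (\\-leftDividesˡ h g))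

  conj≡∙comm : ∀ g h → conj g h ≡ g ∙ comm g h
  conj≡∙comm g h = begin
    h ⁻¹ ∙ g ∙ h                   ≡⟨ cong (_∙ h) (\\-leftDividesˡ g _) ⟨
    g ∙ (g ⁻¹ ∙ (h ⁻¹ ∙ g)) ∙ h    ≡⟨ cong (λ z → g ∙ z ∙ h) (assoc _ _ _) ⟨
    g ∙ (g ⁻¹ ∙ h ⁻¹ ∙ g) ∙ h      ≡⟨ assoc _ _ _ ⟩
    g ∙ comm g h                   ∎

  combination : ∀ {r} → Vec Carrier r → Vec Bool r → Carrier
  combination []      []      = ε
  combination (a ∷ L) (b ∷ u) = (if b then a else ε) ∙ combination L u

  pow-ε : ∀ n → pow ε n ≡ ε
  pow-ε zero    = refl
  pow-ε (suc n) = trans (identityˡ _) (pow-ε n)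

  pow-+ : ∀ g m n → pow g (m + n) ≡ pow g m ∙ pow g n
  pow-+ g zero    n = sym (identityˡ _)
  pow-+ g (suc m) n = trans (cong (g ∙_) (pow-+ g m n)) (sym (assoc _ _ _))

  pow-* : ∀ g m q → pow g (q * m) ≡ pow (pow g m) q
  pow-* g m zero    = refl
  pow-* g m (suc q) = trans (pow-+ g m (q * m)) (cong (pow g m ∙_) (pow-* g m q))

  infix 4 _∈ᴳ_
  _∈ᴳ_ : Carrier → Subset order → Set
  g ∈ᴳ K = index g ∈ K

  ∈ᴳ⇒⊆ : ∀ {K L} → (∀ {g} → g ∈ᴳ K → g ∈ᴳ L) → K ⊆ L
  ∈ᴳ⇒⊆ {K} {L} K⊆L {i} i∈K =
    subst (_∈ L) (index-elem i) (K⊆L (subst (_∈ K) (sym (index-elem i)) i∈K))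

  subset : (P : Carrier → Set) → (∀ g → Dec (P g)) → Subset order
  subset P P? = tabulate (λ i → does (P? (elem i)))

  module _ {P : Carrier → Set} (P? : ∀ g → Dec (P g)) where

    ∈-subset⁺ : ∀ {g} → P g → g ∈ᴳ subset P P?
    ∈-subset⁺ {g} p = lookup⇒[]= (index g) (subset P P?)
      (trans (lookup∘tabulate _ (index g)) (dec-true (P? _) (subst P (sym (elem-index g)) p)))

    ∈-subset⁻ : ∀ {g} → g ∈ᴳ subset P P? → P g
    ∈-subset⁻ {g} g∈ with P? (elem (index g)) | trans (sym (lookup∘tabulate _ (index g))) ([]=⇒lookup g∈)
    ... | yes p | _  = subst P (elem-index g) p
    ... | no _  | ()

  record IsSubgroup (H : Carrier → Set) : Set where
    field
      ε-closed  : H ε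
      ∙-closed  : ∀ {x y} → H x → H y → H (x ∙ y)
      ⁻¹-closed : ∀ {x} → H x → H (x ⁻¹)

  record IsNormalSubgroup (N : Carrier → Set) : Set where
    field
      isSubgroup   : IsSubgroup N
      conj-closed  : ∀ {x} h → N x → N (conj x h)
    open IsSubgroup isSubgroup public

  IsNormalSubgroup-resp : ∀ {N N′} → (∀ {g} → N g → N′ g) → (∀ {g} → N′ g → N g) →
                          IsNormalSubgroup N → IsNormalSubgroup N′
  IsNormalSubgroup-resp to from N-normal = record
    { isSubgroup = record
      { ε-closed  = to ε-closed
      ; ∙-closed  = λ x y → to (∙-closed (from x) (from y))
      ; ⁻¹-closed = λ x → to (⁻¹-closed (from x)) }
    ; conj-closed = λ h x → to (conj-closed h (from x)) }
    where open IsNormalSubgroup N-normal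

  Gen-isSubgroup : ∀ {S} → IsSubgroup (Gen S)
  Gen-isSubgroup = record { ε-closed = gε ; ∙-closed = g∙ ; ⁻¹-closed = g⁻¹ }

  Gen-minimal : ∀ {S H} → IsSubgroup H → (∀ {x} → S x → H x) → ∀ {x} → Gen S x → H x
  Gen-minimal H-sub S⊆H (gen s)  = S⊆H s
  Gen-minimal H-sub S⊆H gε       = ε-closed
    where open IsSubgroup H-sub
  Gen-minimal H-sub S⊆H (g∙ p q) = ∙-closed (Gen-minimal H-sub S⊆H p) (Gen-minimal H-sub S⊆H q)
    where open IsSubgroup H-sub
  Gen-minimal H-sub S⊆H (g⁻¹ p)  = ⁻¹-closed (Gen-minimal H-sub S⊆H p)
    where open IsSubgroup H-sub

  Gen-mono : ∀ {S T} → (∀ {x} → S x → Gen T x) → ∀ {x} → Gen S x → Gen T x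
  Gen-mono = Gen-minimal Gen-isSubgroup

  combination-Gen : ∀ {r} (L : Vec Carrier r) u → Gen (InTuple L) (combination L u)
  combination-Gen []      []      = gε
  combination-Gen (a ∷ L) (b ∷ u) =
    g∙ (head b) (Gen-mono (λ { (i , e) → gen (suc i , e) }) (combination-Gen L u))
    where
    head : ∀ b → Gen (InTuple (a ∷ L)) (if b then a else ε)
    head true  = gen (zero , refl)
    head false = gε

module Homomorphism (G H : FinGroup) (f : FinGroup.Carrier G → FinGroup.Carrier H) (f-∙ : IsHom G H f) where
  private
    module G = FinGroupProperties G
    module H = FinGroupProperties H

  f-ε : f G.ε ≡ H.ε
  f-ε = H.∙-cancelˡ (f G.ε) _ _
    (trans (sym (f-∙ G.ε G.ε)) (trans (cong f (G.identityʳ G.ε)) (sym (H.identityʳ _))))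

  f-⁻¹ : ∀ g → f (g G.⁻¹) ≡ f g H.⁻¹
  f-⁻¹ g = H.inverseʳ-unique (f g) _ (trans (sym (f-∙ g (g G.⁻¹))) (trans (cong f (G.inverseʳ g)) f-ε))

  f-pow : ∀ g n → f (G.pow g n) ≡ H.pow (f g) n
  f-pow g zero    = f-ε
  f-pow g (suc n) = trans (f-∙ _ _) (cong (f g H.∙_) (f-pow g n))

  f-prod : ∀ {r} (L : Vec G.Carrier r) → f (G.prod L) ≡ H.prod (map f L)
  f-prod []      = f-ε
  f-prod (a ∷ L) = trans (f-∙ _ _) (cong (f a H.∙_) (f-prod L))

  f-conj : ∀ g h → f (G.conj g h) ≡ H.conj (f g) (f h)
  f-conj g h = trans (f-∙ _ h) (cong (H._∙ f h) (trans (f-∙ _ g) (cong (H._∙ f g) (f-⁻¹ h))))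

  f-SemiConjugate : ∀ {k} {v w : Vec G.Carrier k} → G.SemiConjugate v w → H.SemiConjugate (map f v) (map f w)
  f-SemiConjugate {v = v} {w} semiconj i with semiconj i
  ... | h , w≡conj = f h , (begin
    lookup (map f w) i               ≡⟨ lookup-map i f w ⟩
    f (lookup w i)                   ≡⟨ cong f w≡conj ⟩
    f (G.conj (lookup v i) h)        ≡⟨ f-conj _ h ⟩
    H.conj (f (lookup v i)) (f h)    ≡⟨ cong (λ a → H.conj a (f h)) (lookup-map i f v) ⟨
    H.conj (lookup (map f v) i) (f h) ∎)
    where open ≡-Reasoning

  f-combination : ∀ {r} (L : Vec G.Carrier r) u → f (G.combination L u) ≡ H.combination (map f L) u
  f-combination []      []          = f-ε
  f-combination (a ∷ L) (true ∷ u)  = trans (f-∙ _ _) (cong (f a H.∙_) (f-combination L u))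
  f-combination (a ∷ L) (false ∷ u) = trans (f-∙ _ _) (cong₂ H._∙_ f-ε (f-combination L u))

  f-Gen : ∀ {k} (x : Vec G.Carrier k) {g} → G.Gen (G.InTuple x) g → H.Gen (H.InTuple (map f x)) (f g)
  f-Gen x = G.Gen-minimal (record
    { ε-closed  = subst (H.Gen _) (sym f-ε) H.gε
    ; ∙-closed  = λ p q → subst (H.Gen _) (sym (f-∙ _ _)) (H.g∙ p q)
    ; ⁻¹-closed = λ p → subst (H.Gen _) (sym (f-⁻¹ _)) (H.g⁻¹ p) })
    (λ { (i , refl) → H.gen (i , lookup-map i f x) })

  surjective-Generates : Surj G H f → ∀ {k} {x : Vec G.Carrier k} → G.Generates x → H.Generates (map f x)
  surjective-Generates f-onto {x = x} gens a with f-onto a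
  ... | g , refl = f-Gen x (gens g)

  surjective-GoodGenerating : Surj G H f → ∀ {k} {x : Vec G.Carrier k} →
                              G.GoodGenerating x → H.GoodGenerating (map f x)
  surjective-GoodGenerating f-onto {x = x} (gens , prod≡ε) =
    surjective-Generates f-onto {x = x} gens , trans (sym (f-prod x)) (trans (cong f prod≡ε) f-ε)

module _ (G : FinGroup) where
  open FinGroupProperties G

  pad-prod : ∀ {s k} {u : Vec Carrier s} {x : Vec Carrier k} → Pad ε u x → prod u ≡ prod x
  pad-prod []         = refl
  pad-prod (keep a p) = cong (a ∙_) (pad-prod p)
  pad-prod (skip p)   = trans (identityˡ _) (pad-prod p)

  pad-Generates : ∀ {s k} {u : Vec Carrier s} {x : Vec Carrier k} → Pad ε u x → Generates x → Generates u
  pad-Generates p gens a = Gen-mono (λ q → gen (pad-∈ p q)) (gens a)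

  pad-Generates⁻ : ∀ {s k} {u : Vec Carrier s} {x : Vec Carrier k} → Pad ε u x → Generates u → Generates x
  pad-Generates⁻ {u = u} {x} p gens a = Gen-mono drop-ε (gens a)
    where
    drop-ε : ∀ {b} → InTuple u b → Gen (InTuple x) b
    drop-ε q with pad-∈⁻ p q
    ... | inj₁ r    = gen r
    ... | inj₂ refl = gε

  -- A tuple semi-conjugate to u has ε at the padded positions, so it pads a tuple semi-conjugate to x.
  pad-Rigid : ∀ {s k} {u : Vec Carrier s} {x : Vec Carrier k} → Pad ε u x → Rigid x → Rigid u
  pad-Rigid {u = u} {x} p (center , (gens , prod≡ε) , rigid) =
    center , (pad-Generates p gens , trans (pad-prod p) prod≡ε) , rigid′
    where
    rigid′ : ∀ w → GoodGenerating w → SemiConjugate u w → Conjugate u w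
    rigid′ w (gens-w , prod-w) sc
      with unpad {R = λ a b → ∃ λ h → b ≡ conj a h} (λ { (h , refl) → conj-ε h }) p {w}
                 (extensional⇒inductive (ext sc))
    ... | w′ , q , sc′ , back
      with rigid w′ (pad-Generates⁻ q gens-w , trans (sym (pad-prod q)) prod-w) (Pointwise.lookup sc′)
    ... | h , cj = h , Pointwise.lookup (back {S = λ a b → b ≡ conj a h} (sym (conj-ε h))
                                               (extensional⇒inductive (ext cj)))

  ε-rational : Rational ε
  ε-rational n _ = ε , trans (conj-ε ε) (sym (pow-ε n))

  pad-Rational : ∀ {s k} {u : Vec Carrier s} {x : Vec Carrier k} → Pad ε u x →
                 (∀ i → Rational (lookup x i)) → ∀ i → Rational (lookup u i)
  pad-Rational = pad-lookup {P = Rational} ε-rational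

module GeneratedSubgroup (G : FinGroup) {k : ℕ} (gs : Vec (FinGroup.Carrier G) k) where
  open FinGroupProperties G

  private
    S = InTuple gs

    OneStepFrom : Subset order → Carrier → Set
    OneStepFrom C x = x ∈ᴳ C ⊎ ∃ λ i → x ∙ lookup gs i ⁻¹ ∈ᴳ C ⊎ x ∙ lookup gs i ∈ᴳ C

    oneStepFrom? : ∀ C x → Dec (OneStepFrom C x)
    oneStepFrom? C x = (index x ∈? C) ⊎-dec any? (λ i → (index _ ∈? C) ⊎-dec (index _ ∈? C))

    extend : Subset order → Subset order
    extend C = subset (OneStepFrom C) (oneStepFrom? C)

    Sound : Subset order → Set
    Sound C = ∀ {x} → x ∈ᴳ C → Gen S x

    extend-sound : ∀ {C} → Sound C → Sound (extend C)
    extend-sound {C} C-sound x∈ with ∈-subset⁻ (oneStepFrom? C) x∈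
    ... | inj₁ x∈C = C-sound x∈C
    ... | inj₂ (i , inj₁ p) = subst (Gen S) (//-rightDividesˡ _ _) (g∙ (C-sound p) (gen (i , refl)))
    ... | inj₂ (i , inj₂ p) = subst (Gen S) (//-rightDividesʳ _ _) (g∙ (C-sound p) (g⁻¹ (gen (i , refl))))

    singletonε : Subset order
    singletonε = subset (_≡ ε) (_≟ ε)

    -- The least subset containing ε and closed under right multiplication by the generators and their
    -- inverses is reached by iterating extend; it is exactly ⟨gs⟩.
    closure : ∃ λ F → Sound F × singletonε ⊆ F × extend F ⊆ F
    closure = fixpoint-above extend (∈ᴳ⇒⊆ (∈-subset⁺ (oneStepFrom? _) ∘ inj₁)) Sound extend-sound
                (λ x∈ → subst (Gen S) (sym (∈-subset⁻ (_≟ ε) x∈)) gε)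

    F = proj₁ closure

    ε∈F : ε ∈ᴳ F
    ε∈F = proj₁ (proj₂ (proj₂ closure)) (∈-subset⁺ (_≟ ε) refl)

    F-extend : ∀ {x} → OneStepFrom F x → x ∈ᴳ F
    F-extend p = proj₂ (proj₂ (proj₂ closure)) (∈-subset⁺ (oneStepFrom? F) p)

    F-closed : ∀ {c x} → Gen S x → c ∈ᴳ F → c ∙ x ∈ᴳ F × c ∙ x ⁻¹ ∈ᴳ F
    F-closed {c} (gen (i , refl)) c∈F =
        F-extend (inj₂ (i , inj₁ (subst (_∈ᴳ F) (sym (//-rightDividesʳ _ c)) c∈F)))
      , F-extend (inj₂ (i , inj₂ (subst (_∈ᴳ F) (sym (//-rightDividesˡ _ c)) c∈F)))
    F-closed {c} gε c∈F =
        subst (_∈ᴳ F) (sym (identityʳ c)) c∈F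
      , subst (_∈ᴳ F) (sym (trans (cong (c ∙_) ε⁻¹≈ε) (identityʳ c))) c∈F
    F-closed {c} (g∙ {x} {y} p q) c∈F =
        subst (_∈ᴳ F) (assoc c x y) (proj₁ (F-closed q (proj₁ (F-closed p c∈F))))
      , subst (_∈ᴳ F) (trans (assoc _ _ _) (cong (c ∙_) (sym (⁻¹-anti-homo-∙ x y))))
              (proj₂ (F-closed p (proj₂ (F-closed q c∈F))))
    F-closed {c} (g⁻¹ {x} p) c∈F =
        proj₂ (F-closed p c∈F)
      , subst (λ z → c ∙ z ∈ᴳ F) (sym (⁻¹-involutive x)) (proj₁ (F-closed p c∈F))

  Gen? : ∀ x → Dec (Gen (InTuple gs) x)
  Gen? x = map′ (proj₁ (proj₂ closure))
                (λ p → subst (_∈ᴳ F) (identityˡ x) (proj₁ (F-closed p ε∈F)))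
                (index x ∈? F)

-- Quotient groups and condition E(p)

module Quotient (G : FinGroup) (M : Subset (FinGroup.order G))
                (M-normal : FinGroupProperties.IsNormalSubgroup G (λ g → FinGroupProperties._∈ᴳ_ G g M)) where
  open FinGroupProperties G
  open IsNormalSubgroup M-normal
  open ≡-Reasoning

  infix 4 _~_
  _~_ : Carrier → Carrier → Set
  g ~ h = g ⁻¹ ∙ h ∈ᴳ M

  _~?_ : ∀ g h → Dec (g ~ h)
  g ~? h = index (g ⁻¹ ∙ h) ∈? M

  ~-refl : ∀ {g} → g ~ g
  ~-refl {g} = subst (_∈ᴳ M) (sym (inverseˡ g)) ε-closed

  ~-sym : ∀ {g h} → g ~ h → h ~ g
  ~-sym {g} {h} g~h = subst (_∈ᴳ M) (trans (⁻¹-anti-homo-∙ _ _) (cong (h ⁻¹ ∙_) (⁻¹-involutive g)))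
                            (⁻¹-closed g~h)

  ~-trans : ∀ {g h k} → g ~ h → h ~ k → g ~ k
  ~-trans {g} {h} {k} g~h h~k = subst (_∈ᴳ M) (trans (assoc _ _ _) (cong (g ⁻¹ ∙_) (\\-leftDividesˡ h k)))
                                      (∙-closed g~h h~k)

  -- Normality of M: (g h)⁻¹ (g′ h′) = h⁻¹ (g⁻¹ g′) h · h⁻¹ h′.
  ~-∙ : ∀ {g g′ h h′} → g ~ g′ → h ~ h′ → g ∙ h ~ g′ ∙ h′
  ~-∙ {g} {g′} {h} {h′} g~g′ h~h′ = subst (_∈ᴳ M) eq (∙-closed (conj-closed h g~g′) h~h′)
    where
    eq : conj (g ⁻¹ ∙ g′) h ∙ (h ⁻¹ ∙ h′) ≡ (g ∙ h) ⁻¹ ∙ (g′ ∙ h′)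
    eq = begin
      h ⁻¹ ∙ (g ⁻¹ ∙ g′) ∙ h ∙ (h ⁻¹ ∙ h′)   ≡⟨ assoc _ _ _ ⟩
      h ⁻¹ ∙ (g ⁻¹ ∙ g′) ∙ (h ∙ (h ⁻¹ ∙ h′)) ≡⟨ cong (h ⁻¹ ∙ (g ⁻¹ ∙ g′) ∙_) (\\-leftDividesˡ h h′) ⟩
      h ⁻¹ ∙ (g ⁻¹ ∙ g′) ∙ h′                ≡⟨ cong (_∙ h′) (sym (assoc _ _ _)) ⟩
      h ⁻¹ ∙ g ⁻¹ ∙ g′ ∙ h′                  ≡⟨ assoc _ _ _ ⟩
      h ⁻¹ ∙ g ⁻¹ ∙ (g′ ∙ h′)                ≡⟨ cong (_∙ (g′ ∙ h′)) (sym (⁻¹-anti-homo-∙ g h)) ⟩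
      (g ∙ h) ⁻¹ ∙ (g′ ∙ h′)                 ∎

  ~-⁻¹ : ∀ {g g′} → g ~ g′ → g ⁻¹ ~ g′ ⁻¹
  ~-⁻¹ {g} {g′} g~g′ = subst (_∈ᴳ M) eq (conj-closed (g ⁻¹) (⁻¹-closed g~g′))
    where
    eq : conj ((g ⁻¹ ∙ g′) ⁻¹) (g ⁻¹) ≡ g ⁻¹ ⁻¹ ∙ g′ ⁻¹
    eq = begin
      g ⁻¹ ⁻¹ ∙ (g ⁻¹ ∙ g′) ⁻¹ ∙ g ⁻¹       ≡⟨ cong (λ z → g ⁻¹ ⁻¹ ∙ z ∙ g ⁻¹) (⁻¹-anti-homo-∙ _ _) ⟩
      g ⁻¹ ⁻¹ ∙ (g′ ⁻¹ ∙ g ⁻¹ ⁻¹) ∙ g ⁻¹    ≡⟨ assoc _ _ _ ⟩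
      g ⁻¹ ⁻¹ ∙ (g′ ⁻¹ ∙ g ⁻¹ ⁻¹ ∙ g ⁻¹)    ≡⟨ cong (g ⁻¹ ⁻¹ ∙_) (//-rightDividesˡ (g ⁻¹) (g′ ⁻¹)) ⟩
      g ⁻¹ ⁻¹ ∙ g′ ⁻¹                        ∎

  -- The canonical representative of a coset is its first element in the enumeration. It is kept opaque:
  -- only ~-canon and canon-cong are used below.
  opaque
    canon : Carrier → Fin order
    canon g = fromMaybe (index g) (first (λ j → g ~? elem j))

    private
      first-~ : ∀ g → ∃ λ j → first (λ j → g ~? elem j) ≡ just j
      first-~ g = first-complete (λ j → g ~? elem j) (subst (g ~_) (sym (elem-index g)) ~-refl)

    ~-canon : ∀ g → g ~ elem (canon g)
    ~-canon g with first-~ g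
    ... | j , e rewrite e = first-sound (λ j → g ~? elem j) e

    canon-cong : ∀ {g h} → g ~ h → canon g ≡ canon h
    canon-cong {g} {h} g~h with first-~ g
    ... | j , e = trans (cong (fromMaybe (index g)) e) (sym (cong (fromMaybe (index h)) e′))
      where
      e′ : first (λ j → h ~? elem j) ≡ just j
      e′ = trans (first-cong (λ j → h ~? elem j) (λ j → g ~? elem j)
                    (λ _ → mk⇔ (~-trans g~h) (~-trans (~-sym g~h)))) e

  Coset : Set
  Coset = Σ (Fin order) λ i → canon (elem i) ≡ i

  Coset-≡ : ∀ {q r : Coset} → proj₁ q ≡ proj₁ r → q ≡ r
  Coset-≡ {i , p} {.i , p′} refl = cong (i ,_) (Decidable⇒UIP.≡-irrelevant _≟ᶠ_ p p′)

  [_] : Carrier → Coset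
  [ g ] = canon g , canon-cong (~-sym (~-canon g))

  rep : Coset → Carrier
  rep q = elem (proj₁ q)

  [rep] : ∀ q → [ rep q ] ≡ q
  [rep] (i , p) = Coset-≡ p

  []-cong : ∀ {g h} → g ~ h → [ g ] ≡ [ h ]
  []-cong g~h = Coset-≡ (canon-cong g~h)

  []-injective : ∀ {g h} → [ g ] ≡ [ h ] → g ~ h
  []-injective {g} {h} e =
    ~-trans (~-canon g) (~-sym (subst (λ i → h ~ elem i) (sym (cong proj₁ e)) (~-canon h)))

  Coset-elim : (P : Coset → Set) → (∀ g → P [ g ]) → ∀ q → P q
  Coset-elim P P[] q = subst P ([rep] q) (P[] (rep q))

  infixl 7 _·_
  infix 8 _′

  _·_ : Coset → Coset → Coset
  q · r = [ rep q ∙ rep r ]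

  _′ : Coset → Coset
  q ′ = [ rep q ⁻¹ ]

  []-∙ : ∀ g h → [ g ∙ h ] ≡ [ g ] · [ h ]
  []-∙ g h = []-cong (~-∙ (~-canon g) (~-canon h))

  []-⁻¹ : ∀ g → [ g ⁻¹ ] ≡ [ g ] ′
  []-⁻¹ g = []-cong (~-⁻¹ (~-canon g))

  ·-assoc : ∀ a b c → (a · b) · c ≡ a · (b · c)
  ·-assoc = Coset-elim _ λ x → Coset-elim _ λ y → Coset-elim _ λ z → begin
    ([ x ] · [ y ]) · [ z ]  ≡⟨ cong (_· [ z ]) (sym ([]-∙ x y)) ⟩
    [ x ∙ y ] · [ z ]        ≡⟨ sym ([]-∙ _ _) ⟩
    [ x ∙ y ∙ z ]            ≡⟨ cong [_] (assoc x y z) ⟩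
    [ x ∙ (y ∙ z) ]          ≡⟨ []-∙ _ _ ⟩
    [ x ] · [ y ∙ z ]        ≡⟨ cong ([ x ] ·_) ([]-∙ y z) ⟩
    [ x ] · ([ y ] · [ z ])  ∎

  ·-identityˡ : ∀ a → [ ε ] · a ≡ a
  ·-identityˡ = Coset-elim _ λ x → trans (sym ([]-∙ ε x)) (cong [_] (identityˡ x))

  ·-identityʳ : ∀ a → a · [ ε ] ≡ a
  ·-identityʳ = Coset-elim _ λ x → trans (sym ([]-∙ x ε)) (cong [_] (identityʳ x))

  ·-inverseˡ : ∀ a → a ′ · a ≡ [ ε ]
  ·-inverseˡ = Coset-elim _ λ x →
    trans (cong (_· [ x ]) (sym ([]-⁻¹ x))) (trans (sym ([]-∙ _ _)) (cong [_] (inverseˡ x)))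

  ·-inverseʳ : ∀ a → a · a ′ ≡ [ ε ]
  ·-inverseʳ = Coset-elim _ λ x →
    trans (cong ([ x ] ·_) (sym ([]-⁻¹ x))) (trans (sym ([]-∙ _ _)) (cong [_] (inverseʳ x)))

  ·-isGroup : IsGroup _≡_ _·_ [ ε ] _′
  ·-isGroup = record
    { isMonoid = record
      { isSemigroup = record
        { isMagma = record { isEquivalence = isEquivalence ; ∙-cong = cong₂ _·_ }
        ; assoc = ·-assoc }
      ; identity = ·-identityˡ , ·-identityʳ }
    ; inverse = ·-inverseˡ , ·-inverseʳ
    ; ⁻¹-cong = cong _′ }

  private
    Coset-enum : Σ ℕ λ r → Fin r ↔ Coset
    Coset-enum = Σ-Fin↔Fin (λ i → canon (elem i) ≟ᶠ i) (λ i → Decidable⇒UIP.≡-irrelevant _≟ᶠ_)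

  G/M : FinGroup
  G/M = record
    { Carrier = Coset ; _∙_ = _·_ ; ε = [ ε ] ; _⁻¹ = _′ ; isGroup = ·-isGroup
    ; order = proj₁ Coset-enum ; enum = proj₂ Coset-enum }

  []-isQuotientMap : IsQuotientMap G G/M [_]
  []-isQuotientMap = []-∙ , λ q → rep q , [rep] q

  []≡ε⇒∈ : ∀ {g} → [ g ] ≡ [ ε ] → g ∈ᴳ M
  []≡ε⇒∈ {g} e =
    subst (_∈ᴳ M) (⁻¹-involutive g) (⁻¹-closed (subst (_∈ᴳ M) (identityʳ _) ([]-injective e)))

  ∈⇒[]≡ε : ∀ {g} → g ∈ᴳ M → [ g ] ≡ [ ε ]
  ∈⇒[]≡ε g∈M = []-cong (subst (_∈ᴳ M) (sym (identityʳ _)) (⁻¹-closed g∈M))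

  module _ (N : FinGroup.NormalSubgroup G/M) where
    open FinGroup.NormalSubgroup N

    preimage-isNormalSubgroup : IsNormalSubgroup (λ g → mem [ g ] ≡ true)
    preimage-isNormalSubgroup = record
      { isSubgroup = record
        { ε-closed  = has-ε
        ; ∙-closed  = λ {x} {y} x∈ y∈ → subst (λ q → mem q ≡ true) (sym ([]-∙ x y)) (has-∙ _ _ x∈ y∈)
        ; ⁻¹-closed = λ {x} x∈ → subst (λ q → mem q ≡ true) (sym ([]-⁻¹ x)) (has-⁻¹ _ x∈) }
      ; conj-closed = λ {x} h x∈ → subst (λ q → mem q ≡ true) (sym (f-conj x h)) (normal _ [ h ] x∈) }
      where open Homomorphism G G/M [_] []-∙ using (f-conj)

module _ (G : FinGroup) where
  open FinGroupProperties G

  isNormalSubgroup? : ∀ K → Dec (IsNormalSubgroup (_∈ᴳ K))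
  isNormalSubgroup? K =
    map′ (λ (e , m , i , c) → record
           { isSubgroup = record { ε-closed = e ; ∙-closed = m _ _ ; ⁻¹-closed = i _ } ; conj-closed = c _ })
         (λ N → let open IsNormalSubgroup N in
                ε-closed , (λ _ _ → ∙-closed) , (λ _ → ⁻¹-closed) , (λ _ → conj-closed))
         ( (index ε ∈? K)
     ×-dec all? (λ x → all? λ y → (index x ∈? K) →-dec (index y ∈? K) →-dec (index (x ∙ y) ∈? K))
     ×-dec all? (λ x → (index x ∈? K) →-dec (index (x ⁻¹) ∈? K))
     ×-dec all? (λ x → all? λ h → (index x ∈? K) →-dec (index (conj x h) ∈? K)))

  SupplementsDerived : (Carrier → Set) → Set
  SupplementsDerived N = ∀ g → ∃₂ λ w c → N w × InDerived c × g ≡ w ∙ c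

  Proper : Subset order → Set
  Proper K = ∃ λ i → i ∉ K

  proper? : ∀ K → Dec (Proper K)
  proper? K = any? (λ i → ¬? (i ∈? K))

  ¬Proper⇒total : ∀ {K} → ¬ Proper K → ∀ g → g ∈ᴳ K
  ¬Proper⇒total {K} ¬proper g = decidable-stable (index g ∈? K) (λ g∉K → ¬proper (index g , g∉K))

  module _ {M : Subset order} (M-normal : IsNormalSubgroup (_∈ᴳ M)) (M-proper : Proper M)
           (M-maximal : ∀ {K} → IsNormalSubgroup (_∈ᴳ K) → M ⊆ K → Proper K → K ⊆ M) where
    open Quotient G M M-normal

    maximal⇒G/M-simple : FinGroup.IsSimple G/M
    maximal⇒G/M-simple = nontrivial , dichotomy
      where
      nontrivial : ∃ λ q → q ≢ [ ε ]
      nontrivial = [ elem (proj₁ M-proper) ] , λ e →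
        proj₂ M-proper (subst (_∈ M) (index-elem _) ([]≡ε⇒∈ e))

      dichotomy : ∀ N → (∀ q → FinGroup.NormalSubgroup.mem N q ≡ true → q ≡ [ ε ])
                      ⊎ (∀ q → FinGroup.NormalSubgroup.mem N q ≡ true)
      dichotomy N = decide (proper? K)
        where
        open FinGroup.NormalSubgroup N
        K? : ∀ g → Dec (mem [ g ] ≡ true)
        K? g = mem [ g ] Bool.≟ true

        K : Subset order
        K = subset _ K?

        K-normal : IsNormalSubgroup (_∈ᴳ K)
        K-normal = IsNormalSubgroup-resp (∈-subset⁺ K?) (∈-subset⁻ K?) (preimage-isNormalSubgroup N)

        M⊆K : M ⊆ K
        M⊆K = ∈ᴳ⇒⊆ λ g∈M → ∈-subset⁺ K? (subst (λ q → mem q ≡ true) (sym (∈⇒[]≡ε g∈M)) has-ε)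

        decide : Dec (Proper K) → (∀ q → mem q ≡ true → q ≡ [ ε ]) ⊎ (∀ q → mem q ≡ true)
        decide (yes K-proper) =
          inj₁ (Coset-elim _ λ g g∈ → ∈⇒[]≡ε (M-maximal K-normal M⊆K K-proper (∈-subset⁺ K? g∈)))
        decide (no ¬proper)   = inj₂ (Coset-elim _ λ g → ∈-subset⁻ K? (¬Proper⇒total ¬proper g))

  module _ {p : ℕ} (Ep : E p G) {N : Carrier → Set} (N? : ∀ g → Dec (N g))
           (N-normal : IsNormalSubgroup N) (N-supplements : SupplementsDerived N) where
    private
      Nˢ : Subset order
      Nˢ = subset N N?

      ProperNormalAbove : Subset order → Set
      ProperNormalAbove K = IsNormalSubgroup (_∈ᴳ K) × Nˢ ⊆ K × Proper K

      properNormalAbove? : ∀ K → Dec (ProperNormalAbove K)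
      properNormalAbove? K = isNormalSubgroup? K ×-dec Nˢ ⊆? K ×-dec proper? K

      -- G/M has order p (being simple), yet it is a quotient of [G,G] since N ⊆ M supplements [G,G].
      no-proper-normal-above : ∀ {M} → ProperNormalAbove M →
                               (∀ {K} → ProperNormalAbove K → M ⊆ K → K ⊆ M) → ⊥
      no-proper-normal-above {M} (M-normal , N⊆M , M-proper) M-maximal =
        proj₂ Ep G/M G/M-order ((λ x _ → [ x ]) , (λ _ _ _ → refl) , (λ x y _ _ → []-∙ x y) , onto)
        where
        open Quotient G M M-normal
        G/M-order : FinGroup.order G/M ≡ p
        G/M-order = proj₁ Ep G/M [_] []-isQuotientMap
          (maximal⇒G/M-simple M-normal M-proper
            (λ K-normal M⊆K K-proper → M-maximal (K-normal , (λ x → M⊆K (N⊆M x)) , K-proper) M⊆K))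
        onto : ∀ q → ∃₂ λ c c-derived → [ c ] ≡ q
        onto q with N-supplements (rep q)
        ... | w , c , Nw , c-derived , rep≡wc =
          c , c-derived , trans ([]-cong c~wc) (trans (cong [_] (sym rep≡wc)) ([rep] q))
          where
          c~wc : c ~ w ∙ c
          c~wc = subst (_∈ᴳ M) (assoc _ _ _)
                       (IsNormalSubgroup.conj-closed M-normal c (N⊆M (∈-subset⁺ N? Nw)))

    E⇒normal-supplement-total : ∀ g → N g
    E⇒normal-supplement-total g with proper? Nˢ
    ... | no ¬proper = ∈-subset⁻ N? (¬Proper⇒total ¬proper g)
    ... | yes proper with maximal-above ProperNormalAbove properNormalAbove?
                            (IsNormalSubgroup-resp (∈-subset⁺ N?) (∈-subset⁻ N?) N-normal , id , proper)
    ...   | M , M-pna , _ , M-maximal = ⊥-elim (no-proper-normal-above M-pna M-maximal)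

  SupplementsDerived-mono : ∀ {N N′} → (∀ {g} → N g → N′ g) →
                            SupplementsDerived N → SupplementsDerived N′
  SupplementsDerived-mono N⊆N′ N-supplements g with N-supplements g
  ... | w , c , Nw , c-derived , g≡wc = w , c , N⊆N′ Nw , c-derived , g≡wc

-- Rational elements and elementary abelian 2-groups

∣n! : ∀ {m n} → 1 ≤ m → m ≤ n → m ∣ n !
∣n! {suc m} _ m≤n = ∣-trans (m∣m*n (m !)) (m≤n⇒m!∣n! m≤n)

module _ (G : FinGroup) where
  open FinGroupProperties G
  open ≡-Reasoning

  -- Two of the powers g⁰, …, g^|G| coincide.
  period : ∀ g → ∃ λ m → 1 ≤ m × m ≤ order × pow g m ≡ ε
  period g with pigeonhole (n<1+n order) (λ (i : Fin (suc order)) → index (pow g (toℕ i)))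
  ... | i , j , i<j , eq =
    toℕ j ∸ toℕ i , m<n⇒0<n∸m i<j , ≤-trans (m∸n≤m (toℕ j) (toℕ i)) (≤-pred (toℕ<n j)) , pow-period
    where
    a = toℕ i
    b = toℕ j
    pow-period : pow g (b ∸ a) ≡ ε
    pow-period = sym (∙-cancelˡ (pow g a) _ _ (begin
      pow g a ∙ ε           ≡⟨ identityʳ _ ⟩
      pow g a               ≡⟨ trans (sym (elem-index _)) (trans (cong elem eq) (elem-index _)) ⟩
      pow g b               ≡⟨ cong (pow g) (sym (m+[n∸m]≡n (<⇒≤ i<j))) ⟩
      pow g (a + (b ∸ a))   ≡⟨ pow-+ g a (b ∸ a) ⟩
      pow g a ∙ pow g (b ∸ a) ∎))

  pow-order! : ∀ g → pow g (order !) ≡ ε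
  pow-order! g with period g
  ... | m , 1≤m , m≤order , gᵐ≡ε with ∣n! 1≤m m≤order
  ... | divides q order!≡q*m = begin
    pow g (order !)    ≡⟨ cong (pow g) order!≡q*m ⟩
    pow g (q * m)      ≡⟨ pow-* g m q ⟩
    pow (pow g m) q    ≡⟨ cong (λ z → pow z q) gᵐ≡ε ⟩
    pow ε q            ≡⟨ pow-ε q ⟩
    ε                  ∎

  coprime-order!∸1 : Coprime (order ! ∸ 1) order
  coprime-order!∸1 {d} (d∣order!∸1 , d∣order) = ∣1⇒≡1 (∣m+n∣m⇒∣n d∣order! d∣order!∸1)
    where
    instance
      order-nonZero : NonZero order
      order-nonZero = nonZeroIndex (index ε)
    1≤d : 1 ≤ d
    1≤d = n≢0⇒n>0 λ { refl → ≢-nonZero⁻¹ order (0∣⇒≡0 d∣order) }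
    d∣order! : d ∣ order ! ∸ 1 + 1
    d∣order! = subst (d ∣_) (sym (m∸n+n≡m (1≤n! order))) (∣n! 1≤d (∣⇒≤ d∣order))

module AbelianGroupProperties (A : FinGroup)
                              (∙-comm : ∀ a b → FinGroup._∙_ A a b ≡ FinGroup._∙_ A b a) where
  open FinGroupProperties A

  abelianGroup : AbelianGroup 0ℓ 0ℓ
  abelianGroup = record { isAbelianGroup = record { isGroup = isGroup ; comm = ∙-comm } }

  open CommutativeSemigroupProperties (AbelianGroup.commutativeSemigroup abelianGroup) public using (interchange)

  involutions-isSubgroup : IsSubgroup (λ a → a ∙ a ≡ ε)
  involutions-isSubgroup = record
    { ε-closed  = identityˡ ε
    ; ∙-closed  = λ {a} {b} a² b² → trans (interchange a b a b) (trans (cong₂ _∙_ a² b²) (identityˡ ε))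
    ; ⁻¹-closed = λ {a} a² → trans (sym (⁻¹-anti-homo-∙ a a)) (trans (cong _⁻¹ a²) ε⁻¹≈ε) }

module ElementaryAbelian2 (A : FinGroup) (∙-comm : ∀ a b → FinGroup._∙_ A a b ≡ FinGroup._∙_ A b a)
                          (a∙a≡ε : ∀ a → FinGroup._∙_ A a a ≡ FinGroup.ε A) where
  open FinGroupProperties A
  open AbelianGroupProperties A ∙-comm using (interchange)
  open ≡-Reasoning

  ⁻¹≡id : ∀ a → a ⁻¹ ≡ a
  ⁻¹≡id a = sym (inverseʳ-unique a a (a∙a≡ε a))

  combination-false : ∀ {r} (L : Vec Carrier r) → combination L (replicate r false) ≡ ε
  combination-false []      = refl
  combination-false (a ∷ L) = trans (identityˡ _) (combination-false L)

  combination-xor : ∀ {r} (L : Vec Carrier r) u v →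
                    combination L u ∙ combination L v ≡ combination L (zipWith _xor_ u v)
  combination-xor []      []      []      = identityˡ ε
  combination-xor (a ∷ L) (b ∷ u) (c ∷ v) =
    trans (interchange _ _ _ _) (cong₂ _∙_ (if-xor b c) (combination-xor L u v))
    where
    if-xor : ∀ b c → (if b then a else ε) ∙ (if c then a else ε) ≡ (if b xor c then a else ε)
    if-xor true  true  = a∙a≡ε a
    if-xor true  false = identityʳ a
    if-xor false c     = identityˡ _

  Span : ∀ {r} → Vec Carrier r → Carrier → Set
  Span L a = ∃ λ u → combination L u ≡ a

  Span? : ∀ {r} (L : Vec Carrier r) a → Dec (Span L a)
  Span? L a = anySubset? (λ u → combination L u ≟ a)

  Span-isSubgroup : ∀ {r} {L : Vec Carrier r} → IsSubgroup (Span L)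
  Span-isSubgroup {L = L} = record
    { ε-closed  = replicate _ false , combination-false L
    ; ∙-closed  = λ { (u , refl) (v , refl) → zipWith _xor_ u v , sym (combination-xor L u v) }
    ; ⁻¹-closed = λ { {a} a∈ → subst (Span L) (sym (⁻¹≡id a)) a∈ } }

  span-here : ∀ {r} {L : Vec Carrier r} a → Span (a ∷ L) a
  span-here {L = L} a = true ∷ replicate _ false , trans (cong (a ∙_) (combination-false L)) (identityʳ a)

  span-there : ∀ {r} {L : Vec Carrier r} {a b} → Span L b → Span (a ∷ L) b
  span-there (u , e) = false ∷ u , trans (identityˡ _) e

  span-lookup : ∀ {r} (L : Vec Carrier r) i → Span L (lookup L i)
  span-lookup (a ∷ L) zero    = span-here a
  span-lookup (a ∷ L) (suc i) = span-there (span-lookup L i)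

  Generates⇒Span : ∀ {d} (gs : Vec Carrier d) → Generates gs → ∀ a → Span gs a
  Generates⇒Span gs gens a =
    Gen-minimal (Span-isSubgroup {L = gs}) (λ { (i , refl) → span-lookup gs i }) (gens a)

  data Independent : ∀ {r} → Vec Carrier r → Set where
    []  : Independent []
    _∷_ : ∀ {r} {L : Vec Carrier r} {a} → ¬ Span L a → Independent L → Independent (a ∷ L)

  combination-kernel : ∀ {r} {L : Vec Carrier r} → Independent L → ∀ u →
                       combination L u ≡ ε → u ≡ replicate r false
  combination-kernel []                 []          _ = refl
  combination-kernel {L = a ∷ L} (a∉ ∷ ind) (true ∷ u) e =
    contradiction (u , trans (inverseʳ-unique a _ e) (⁻¹≡id a)) a∉
  combination-kernel (a∉ ∷ ind) (false ∷ u) e =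
    cong (false ∷_) (combination-kernel ind u (trans (sym (identityˡ _)) e))

  combination-injective : ∀ {r} {L : Vec Carrier r} → Independent L → ∀ {u v} →
                          combination L u ≡ combination L v → u ≡ v
  combination-injective {L = L} ind {u} {v} e = xor≡false⇒≡ u v (combination-kernel ind _ (begin
    combination L (zipWith _xor_ u v)        ≡⟨ sym (combination-xor L u v) ⟩
    combination L u ∙ combination L v        ≡⟨ cong (_∙ combination L v) e ⟩
    combination L v ∙ combination L v        ≡⟨ a∙a≡ε _ ⟩
    ε                                        ∎))
    where
    xor≡false⇒≡ : ∀ {r} (u v : Vec Bool r) → zipWith _xor_ u v ≡ replicate r false → u ≡ v
    xor≡false⇒≡ []      []      _ = refl
    xor≡false⇒≡ (true  ∷ u) (true  ∷ v) e = cong (true ∷_) (xor≡false⇒≡ u v (cong tail e))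
    xor≡false⇒≡ (false ∷ u) (false ∷ v) e = cong (false ∷_) (xor≡false⇒≡ u v (cong tail e))
    xor≡false⇒≡ (true  ∷ u) (false ∷ v) ()
    xor≡false⇒≡ (false ∷ u) (true  ∷ v) ()

  independent-length≤ : ∀ {r d} {L : Vec Carrier r} → Independent L →
                        (gs : Vec Carrier d) → Generates gs → r ≤ d
  independent-length≤ {L = L} ind gs gens = Vec-Bool-injective⇒≤ coordinates
    λ {u} {v} e → combination-injective ind (begin
      combination L u                 ≡⟨ sym (proj₂ (Generates⇒Span gs gens _)) ⟩
      combination gs (coordinates u)  ≡⟨ cong (combination gs) e ⟩
      combination gs (coordinates v)  ≡⟨ proj₂ (Generates⇒Span gs gens _) ⟩
      combination L v                 ∎)
    where
    coordinates : Vec Bool _ → Vec Bool _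
    coordinates u = proj₁ (Generates⇒Span gs gens (combination L u))

  record IndependentSpanningSubfamily {k} (ys : Vec Carrier k) : Set where
    field
      chosen      : Vec Bool k
      independent : Independent (select chosen ys)
      spans       : ∀ i → Span (select chosen ys) (lookup ys i)

  greedy : ∀ {k} (ys : Vec Carrier k) → IndependentSpanningSubfamily ys
  greedy []       = record { chosen = [] ; independent = [] ; spans = λ () }
  greedy (a ∷ ys) with greedy ys
  ... | record { chosen = f ; independent = ind ; spans = sp } with Span? (select f ys) a
  ...   | yes a∈ = record { chosen = false ∷ f ; independent = ind
                          ; spans = λ { zero → a∈ ; (suc i) → sp i } }
  ...   | no a∉  = record { chosen = true ∷ f ; independent = a∉ ∷ ind
                          ; spans = λ { zero → span-here a ; (suc i) → span-there (sp i) } }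

module Abelianization (G A : FinGroup) (π : FinGroup.Carrier G → FinGroup.Carrier A)
                      (π-ab : IsAbelianization G A π) where
  private
    module G = FinGroupProperties G
    module A = FinGroupProperties A
  open ≡-Reasoning

  π-∙ : IsHom G A π
  π-∙ = proj₁ (proj₁ π-ab)

  open Homomorphism G A π π-∙ renaming (f-ε to π-ε; f-⁻¹ to π-⁻¹; f-combination to π-combination)

  π-conj : ∀ g h → π (G.conj g h) ≡ π g
  π-conj g h = begin
    π (G.conj g h)             ≡⟨ cong π (G.conj≡∙comm g h) ⟩
    π (g G.∙ G.comm g h)       ≡⟨ π-∙ g _ ⟩
    π g A.∙ π (G.comm g h)     ≡⟨ cong (π g A.∙_) (proj₂ (proj₂ π-ab _) (G.gen (g , h , refl))) ⟩
    π g A.∙ A.ε                ≡⟨ A.identityʳ _ ⟩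
    π g                        ∎

  A-comm : ∀ a b → a A.∙ b ≡ b A.∙ a
  A-comm a b with proj₂ (proj₁ π-ab) a | proj₂ (proj₁ π-ab) b
  ... | g , refl | h , refl = begin
    π g A.∙ π h                ≡⟨ π-∙ g h ⟨
    π (g G.∙ h)                ≡⟨ cong π (G.∙-conj g h) ⟨
    π (h G.∙ G.conj g h)       ≡⟨ π-∙ h _ ⟩
    π h A.∙ π (G.conj g h)     ≡⟨ cong (π h A.∙_) (π-conj g h) ⟩
    π h A.∙ π g                ∎

  -- g is conjugate to g^(|G|! - 1), and g^|G|! = ε.
  rational⇒π²≡ε : ∀ {g} → G.Rational g → π g A.∙ π g ≡ A.ε
  rational⇒π²≡ε {g} g-rational with g-rational (G.order ! ∸ 1) (coprime-order!∸1 G)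
  ... | h , conj≡pow = begin
    π g A.∙ π g              ≡⟨ cong (π g A.∙_) (trans (sym (π-conj g h)) (cong π conj≡pow)) ⟩
    π g A.∙ π (G.pow g N)    ≡⟨ π-∙ g _ ⟨
    π (G.pow g (suc N))      ≡⟨ cong (π ∘ G.pow g) (trans (+-comm 1 N) (m∸n+n≡m (1≤n! G.order))) ⟩
    π (G.pow g (G.order !))  ≡⟨ cong π (pow-order! G g) ⟩
    π G.ε                    ≡⟨ π-ε ⟩
    A.ε                      ∎
    where
    N = G.order ! ∸ 1

  module ChosenGenerators {k} (x : Vec G.Carrier k) (x-generates : G.Generates x)
           (x-rational : ∀ i → G.Rational (lookup x i)) where

    A-generated : A.Generates (map π x)
    A-generated = surjective-Generates (proj₂ (proj₁ π-ab)) {x = x} x-generates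

    A-exponent-2 : ∀ a → a A.∙ a ≡ A.ε
    A-exponent-2 a = A.Gen-minimal (AbelianGroupProperties.involutions-isSubgroup A A-comm)
      (λ { (i , refl) → subst (λ a → a A.∙ a ≡ A.ε) (sym (lookup-map i π x)) (rational⇒π²≡ε (x-rational i)) })
      (A-generated a)

    open ElementaryAbelian2 A A-comm A-exponent-2
    open IndependentSpanningSubfamily (greedy (map π x)) public using (chosen)
    open IndependentSpanningSubfamily (greedy (map π x)) using (independent; spans)

    chosen-length≤ : ∀ {d} → A.MinGenerators d → trues chosen ≤ d
    chosen-length≤ ((gs , gs-generate) , _) = independent-length≤ independent gs gs-generate

    chosen-span : ∀ a → Span (map π (select chosen x)) a
    chosen-span a = subst (λ L → Span L a) (select-map π chosen x)
      (A.Gen-minimal (Span-isSubgroup {L = select chosen (map π x)}) (λ { (i , refl) → spans i }) (A-generated a))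

    -- g = w (w⁻¹ g) with w a product of chosen entries having the same image as g.
    chosen-supplements : SupplementsDerived G (G.Gen (G.InTuple (select chosen x)))
    chosen-supplements g with chosen-span (π g)
    ... | u , πw≡πg =
      w , w G.⁻¹ G.∙ g , G.combination-Gen (select chosen x) u , derived , sym (G.\\-leftDividesˡ w g)
      where
      w = G.combination (select chosen x) u
      derived : G.InDerived (w G.⁻¹ G.∙ g)
      derived = proj₁ (proj₂ π-ab _) (begin
        π (w G.⁻¹ G.∙ g)      ≡⟨ π-∙ _ g ⟩
        π (w G.⁻¹) A.∙ π g    ≡⟨ cong (A._∙ π g) (π-⁻¹ w) ⟩
        π w A.⁻¹ A.∙ π g      ≡⟨ cong (λ a → a A.⁻¹ A.∙ π g) (trans (π-combination (select chosen x) u) πw≡πg) ⟩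
        π g A.⁻¹ A.∙ π g      ≡⟨ A.inverseˡ (π g) ⟩
        A.ε                   ∎)

-- Direct products

module Product (G₁ G₂ : FinGroup) where
  private
    module G₁ = FinGroupProperties G₁
    module G₂ = FinGroupProperties G₂
    module P = FinGroupProperties (G₁ ⊗ G₂)
    module π₁ = Homomorphism (G₁ ⊗ G₂) G₁ proj₁ (λ _ _ → refl)
    module π₂ = Homomorphism (G₁ ⊗ G₂) G₂ proj₂ (λ _ _ → refl)

  pow-⊗ : ∀ a b n → P.pow (a , b) n ≡ (G₁.pow a n , G₂.pow b n)
  pow-⊗ a b n = cong₂ _,_ (π₁.f-pow (a , b) n) (π₂.f-pow (a , b) n)

  ⊗-Rational : ∀ {a b} → G₁.Rational a → G₂.Rational b → P.Rational (a , b)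
  ⊗-Rational {a} {b} a-rational b-rational n coprime
    with a-rational n (λ (d∣n , d∣order) → coprime (d∣n , ∣m⇒∣m*n G₂.order d∣order))
       | b-rational n (λ (d∣n , d∣order) → coprime (d∣n , ∣n⇒∣m*n G₁.order d∣order))
  ... | h₁ , e₁ | h₂ , e₂ = (h₁ , h₂) , trans (cong₂ _,_ e₁ e₂) (sym (pow-⊗ a b n))

  ⊗-TrivialCenter : G₁.TrivialCenter → G₂.TrivialCenter → P.TrivialCenter
  ⊗-TrivialCenter center₁ center₂ (z₁ , z₂) central =
    cong₂ _,_ (center₁ z₁ λ a → cong proj₁ (central (a , G₂.ε)))
              (center₂ z₂ λ b → cong proj₂ (central (G₁.ε , b)))

  Conjugate-⊗ : ∀ {s} {v w : Vec P.Carrier s} → G₁.Conjugate (map proj₁ v) (map proj₁ w) →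
                G₂.Conjugate (map proj₂ v) (map proj₂ w) → P.Conjugate v w
  Conjugate-⊗ {v = v} {w} (h₁ , conj₁) (h₂ , conj₂) = (h₁ , h₂) , λ i → cong₂ _,_
    (trans (sym (lookup-map i proj₁ w)) (trans (conj₁ i) (cong (λ a → G₁.conj a h₁) (lookup-map i proj₁ v))))
    (trans (sym (lookup-map i proj₂ w)) (trans (conj₂ i) (cong (λ b → G₂.conj b h₂) (lookup-map i proj₂ v))))

  ⊗-Rigid : ∀ {s} {v : Vec P.Carrier s} → G₁.Rigid (map proj₁ v) → G₂.Rigid (map proj₂ v) →
            P.Generates v → P.Rigid v
  ⊗-Rigid {v = v} (center₁ , (_ , prod₁≡ε) , rigid₁) (center₂ , (_ , prod₂≡ε) , rigid₂) v-generates =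
    ⊗-TrivialCenter center₁ center₂ ,
    (v-generates , cong₂ _,_ (trans (π₁.f-prod v) prod₁≡ε) (trans (π₂.f-prod v) prod₂≡ε)) ,
    λ w w-good semiconj → Conjugate-⊗ {v = v} {w}
      (rigid₁ (map proj₁ w) (π₁.surjective-GoodGenerating proj₁-onto {x = w} w-good)
                            (π₁.f-SemiConjugate {v = v} {w} semiconj))
      (rigid₂ (map proj₂ w) (π₂.surjective-GoodGenerating proj₂-onto {x = w} w-good)
                            (π₂.f-SemiConjugate {v = v} {w} semiconj))
    where
    proj₁-onto : Surj (G₁ ⊗ G₂) G₁ proj₁
    proj₁-onto a = (a , G₂.ε) , refl
    proj₂-onto : Surj (G₁ ⊗ G₂) G₂ proj₂
    proj₂-onto b = (G₁.ε , b) , refl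

  module _ {s} (v : Vec P.Carrier s) where
    private
      H : P.Carrier → Set
      H = P.Gen (P.InTuple v)

      H-conj : ∀ {a b} → H a → H b → H (P.conj a b)
      H-conj ha hb = P.g∙ (P.g∙ (P.g⁻¹ hb) ha) hb

    Slice₁ : G₁.Carrier → Set
    Slice₁ g = H (g , G₂.ε)

    Slice₂ : G₂.Carrier → Set
    Slice₂ g = H (G₁.ε , g)

    slice₁? : ∀ g → Dec (Slice₁ g)
    slice₁? g = GeneratedSubgroup.Gen? (G₁ ⊗ G₂) v (g , G₂.ε)

    slice₂? : ∀ g → Dec (Slice₂ g)
    slice₂? g = GeneratedSubgroup.Gen? (G₁ ⊗ G₂) v (G₁.ε , g)

    -- Every element of G₁ is the first coordinate of some element of H, which conjugates Slice₁ into itself.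
    slice₁-isNormalSubgroup : G₁.Generates (map proj₁ v) → G₁.IsNormalSubgroup Slice₁
    slice₁-isNormalSubgroup v₁-generates = record
      { isSubgroup = record
        { ε-closed  = P.gε
        ; ∙-closed  = λ p q → subst (λ b → H (_ , b)) (G₂.identityˡ _) (P.g∙ p q)
        ; ⁻¹-closed = λ p → subst (λ b → H (_ , b)) G₂.ε⁻¹≈ε (P.g⁻¹ p) }
      ; conj-closed = λ h p → let h′ , q = lift h in subst (λ b → H (_ , b)) (G₂.conj-ε h′) (H-conj p q) }
      where
      lift : ∀ g → ∃ λ h → H (g , h)
      lift g = G₁.Gen-minimal {H = λ g → ∃ λ h → H (g , h)}
        (record { ε-closed  = G₂.ε , P.gε
                ; ∙-closed  = λ (h , p) (h′ , q) → h G₂.∙ h′ , P.g∙ p q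
                ; ⁻¹-closed = λ (h , p) → h G₂.⁻¹ , P.g⁻¹ p })
        (λ { (i , refl) → proj₂ (lookup v i) ,
                          P.gen (i , cong (_, proj₂ (lookup v i)) (sym (lookup-map i proj₁ v))) })
        (v₁-generates g)

    slice₂-isNormalSubgroup : G₂.Generates (map proj₂ v) → G₂.IsNormalSubgroup Slice₂
    slice₂-isNormalSubgroup v₂-generates = record
      { isSubgroup = record
        { ε-closed  = P.gε
        ; ∙-closed  = λ p q → subst (λ a → H (a , _)) (G₁.identityˡ _) (P.g∙ p q)
        ; ⁻¹-closed = λ p → subst (λ a → H (a , _)) G₁.ε⁻¹≈ε (P.g⁻¹ p) }
      ; conj-closed = λ h p → let h′ , q = lift h in subst (λ a → H (a , _)) (G₁.conj-ε h′) (H-conj p q) }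
      where
      lift : ∀ g → ∃ λ h → H (h , g)
      lift g = G₂.Gen-minimal {H = λ g → ∃ λ h → H (h , g)}
        (record { ε-closed  = G₁.ε , P.gε
                ; ∙-closed  = λ (h , p) (h′ , q) → h G₁.∙ h′ , P.g∙ p q
                ; ⁻¹-closed = λ (h , p) → h G₁.⁻¹ , P.g⁻¹ p })
        (λ { (i , refl) → proj₁ (lookup v i) ,
                          P.gen (i , cong (proj₁ (lookup v i) ,_) (sym (lookup-map i proj₂ v))) })
        (v₂-generates g)

    ⊗-Generates : ∀ {p} → E p G₁ → E p G₂ → G₁.Generates (map proj₁ v) → G₂.Generates (map proj₂ v) →
                  ∀ {S₁ S₂} → (∀ {a} → S₁ a → P.InTuple v (a , G₂.ε)) →
                              (∀ {b} → S₂ b → P.InTuple v (G₁.ε , b)) →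
                  SupplementsDerived G₁ (G₁.Gen S₁) → SupplementsDerived G₂ (G₂.Gen S₂) → P.Generates v
    ⊗-Generates E₁ E₂ v₁-generates v₂-generates S₁⊆v S₂⊆v supplements₁ supplements₂ (g , h) =
      subst H (cong₂ _,_ (G₁.identityʳ g) (G₂.identityˡ h)) (P.g∙ (slice₁-total g) (slice₂-total h))
      where
      slice₁-normal = slice₁-isNormalSubgroup v₁-generates
      slice₂-normal = slice₂-isNormalSubgroup v₂-generates
      slice₁-total = E⇒normal-supplement-total G₁ E₁ slice₁? slice₁-normal
        (SupplementsDerived-mono G₁ (G₁.Gen-minimal (G₁.IsNormalSubgroup.isSubgroup slice₁-normal) (P.gen ∘ S₁⊆v))
                                    supplements₁)
      slice₂-total = E⇒normal-supplement-total G₂ E₂ slice₂? slice₂-normal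
        (SupplementsDerived-mono G₂ (G₂.Gen-minimal (G₂.IsNormalSubgroup.isSubgroup slice₂-normal) (P.gen ∘ S₂⊆v))
                                    supplements₂)

    ⊗-Rational-entries : (∀ i → G₁.Rational (lookup (map proj₁ v) i)) →
                         (∀ i → G₂.Rational (lookup (map proj₂ v) i)) → ∀ i → P.Rational (lookup v i)
    ⊗-Rational-entries rational₁ rational₂ i = subst P.Rational
      (cong₂ _,_ (lookup-map i proj₁ v) (lookup-map i proj₂ v)) (⊗-Rational (rational₁ i) (rational₂ i))

-- The projection Carrier of Defs, hidden at the top since it clashes with the field opened by FinGroupProperties.
open Defs using (Carrier)

proposition7p7 : ∀ (p : ℕ) → Prime p →
    ∀ (G₁ G₂ : FinGroup) → E p G₁ → E p G₂ →
    ∀ (k₁ k₂ : ℕ) →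
    FinGroup.AdmitsRationalRigid G₁ k₁ → FinGroup.AdmitsRationalRigid G₂ k₂ →
    ∀ (A₁ A₂ : FinGroup) (π₁ : Carrier G₁ → Carrier A₁) (π₂ : Carrier G₂ → Carrier A₂) →
    IsAbelianization G₁ A₁ π₁ → IsAbelianization G₂ A₂ π₂ →
    ∀ (d₁ d₂ : ℕ) → FinGroup.MinGenerators A₁ d₁ → FinGroup.MinGenerators A₂ d₂ →
    FinGroup.AdmitsRationalRigid (G₁ ⊗ G₂) (d₁ + d₂ + ((k₁ ∸ d₁) ⊔ (k₂ ∸ d₂)))
proposition7p7 p _ G₁ G₂ E₁ E₂ k₁ k₂ (x₁ , rigid₁@(_ , (gens₁ , _) , _) , rational₁)
               (x₂ , rigid₂@(_ , (gens₂ , _) , _) , rational₂) A₁ A₂ π₁ π₂ ab₁ ab₂ d₁ d₂ min₁ min₂ =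
  v , Product.⊗-Rigid G₁ G₂ {v = v} (pad-Rigid G₁ pad₁ rigid₁) (pad-Rigid G₂ pad₂ rigid₂) v-generates
    , Product.⊗-Rational-entries G₁ G₂ v (pad-Rational G₁ pad₁ rational₁) (pad-Rational G₂ pad₂ rational₂)
  where
  module C₁ = Abelianization.ChosenGenerators G₁ A₁ π₁ ab₁ x₁ gens₁ rational₁
  module C₂ = Abelianization.ChosenGenerators G₂ A₂ π₂ ab₂ x₂ gens₂ rational₂
  open Merge (FinGroup.ε G₁) (FinGroup.ε G₂)
  open Padded x₁ C₁.chosen x₂ C₂.chosen
         (mergeLength-bound C₁.chosen C₂.chosen (C₁.chosen-length≤ min₁) (C₂.chosen-length≤ min₂))
    renaming (merged to v; merged-pad₁ to pad₁; merged-pad₂ to pad₂)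

  v-generates : FinGroup.Generates (G₁ ⊗ G₂) v
  v-generates = Product.⊗-Generates G₁ G₂ v E₁ E₂
    (pad-Generates G₁ pad₁ gens₁) (pad-Generates G₂ pad₂ gens₂)
    merged-chosen₁ merged-chosen₂ C₁.chosen-supplements C₂.chosen-supplements
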